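{- Let $w\in S_n$ avoid the patterns $3412$ and $4231$, and let $w(d)=n$ and $w(n)=e$. Then at least one of the following holds: (1) $w(d)>w(d+1)>\cdots>w(n)$; (2) $w^{ -1}(e)>w^{ -1}(e+1)>\cdots>w^{ -1}(n)$. Moreover, $R_w(q)=[m+1]_q\,R_{w'}(q)$, where $w'=\mathrm{flat}(w,d)$ and $m=n-d$ if (1) holds, and $w'=\mathrm{flat}(w,n)$ and $m=n-e$ if (2) holds.
   Context: For $w\in S_n$ and $k\in\{1,\dots,n\}$, $\mathrm{flat}(w,k)\in S_{n-1}$ is the permutation whose entries have the same relative order as the sequence $w(1),\dots,w(k-1),w(k+1),\dots,w(n)$. The inversion graph $G_w$ has vertices $\{1,\dots,n\}$ and edges $\{i,j\}$ for $i<j$ with $w(i)>w(j)$. For a graph $G$, $R_G(q)=\sum_{\mathcal{O}}q^{\mathrm{des}(\mathcal{O})}$ over acyclic orientations $\mathcal{O}$ of $G$, where $\mathrm{des}(\mathcal{O})$ is the number of edges oriented $i\to j$ with $i>j$; $R_w(q)=R_{G_w}(q)$. $[a]_q=1+q+\cdots+q^{a-1}$. Pattern avoidance: $w$ avoids $\sigma\in S_k$ if no length-$k$ subsequence of $w(1)\cdots w(n)$ has the same relative order as $\sigma$. -}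

module Defs where

open import Data.Nat using (ℕ; zero; suc; _+_; _*_; _∸_)
open import Data.Nat.Properties using () renaming (_<?_ to _<ℕ?_)
open import Data.Bool using (Bool; true; false; _∧_; not; if_then_else_)
import Data.Fin as Fin
open import Data.Fin using (Fin; toℕ; _<_; _≤_) renaming (_<?_ to _<ᶠ?_; _≟_ to _≟ᶠ_)
open import Data.Fin.Permutation using (Permutation′; _⟨$⟩ʳ_; _⟨$⟩ˡ_; remove)
open import Data.List using (List; []; _∷_; map; filter; length; upTo; allFin; concatMap; zip; applyUpTo)
open import Data.Nat.ListAction using (sum)
open import Data.Bool.ListAction using (any)
open import Data.Product using (_×_; _,_; ∃; Σ)
open import Data.Vec using (Vec; lookup; _∷_; [])
open import Relation.Nullary using (¬_; ⌊_⌋)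
open import Relation.Binary.PropositionalEquality using (_≡_)
open import Function.Bundles using (_⇔_)

-- All indices are 0-based: Fin N stands for {1,…,N}.

-- Polynomials in q with ℕ coefficients, as coefficient functions
-- (P k = coefficient of q^k).

Poly : Set
Poly = ℕ → ℕ

_⊛_ : Poly → Poly → Poly
(f ⊛ g) k = sum (map (λ i → f i * g (k ∸ i)) (upTo (suc k)))

-- [a]_q = 1 + q + ⋯ + q^(a-1)
qint : ℕ → Poly
qint a k = if ⌊ k <ℕ? a ⌋ then 1 else 0

_≈ₚ_ : Poly → Poly → Set
f ≈ₚ g = ∀ k → f k ≡ g k

-- Graphs on vertex set Fin n, given by a (Boolean) adjacency relation,
-- of which only pairs i < j are used.

Graph : ℕ → Set
Graph n = Fin n → Fin n → Bool

edges : ∀ {n} → Graph n → List (Fin n × Fin n)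
edges {n} G =
  filter (λ p → Data.Bool._≟_ (lt p) true)
         (concatMap (λ i → map (λ j → (i , j)) (allFin n)) (allFin n))
  where
  lt : Fin n × Fin n → Bool
  lt (i , j) = ⌊ i <ᶠ? j ⌋ ∧ G i j

-- An orientation assigns a Bool to each edge (in the order of 'edges G'):
-- for the edge (i , j) with i < j, 'false' means i → j and 'true'
-- means j → i (i.e. the edge is oriented from the larger vertex to the
-- smaller, a descent).
allBoolLists : ℕ → List (List Bool)
allBoolLists zero = [] ∷ []
allBoolLists (suc m) =
  concatMap (λ bs → (false ∷ bs) ∷ (true ∷ bs) ∷ []) (allBoolLists m)

orientations : ∀ {n} → Graph n → List (List Bool)
orientations G = allBoolLists (length (edges G))

_==ᶠ_ : ∀ {n} → Fin n → Fin n → Bool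
i ==ᶠ j = ⌊ i ≟ᶠ j ⌋

arc : ∀ {n} → (G : Graph n) → List Bool → Fin n → Fin n → Bool
arc G o a b = any step (zip (edges G) o)
  where
  step : _ → Bool
  step ((i , j) , false) = (i ==ᶠ a) ∧ (j ==ᶠ b)
  step ((i , j) , true)  = (j ==ᶠ a) ∧ (i ==ᶠ b)

des : List Bool → ℕ
des o = length (filter (λ b → Data.Bool._≟_ b true) o)

walk : ∀ {n} → Graph n → List Bool → ℕ → Fin n → Fin n → Bool
walk G o zero a b = a ==ᶠ b
walk {n} G o (suc ℓ) a b = any (λ c → arc G o a c ∧ walk G o ℓ c b) (allFin n)

-- o has a directed cycle: a closed directed walk of length ℓ with
-- 1 ≤ ℓ ≤ n (every directed cycle has length ≤ n, and every closed walk
-- of positive length contains a directed cycle).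
hasCycle : ∀ {n} → Graph n → List Bool → Bool
hasCycle {n} G o =
  any (λ a → any (λ ℓ → walk G o (suc ℓ) a a) (upTo n)) (allFin n)

-- R_G(q) = Σ_{acyclic orientations O} q^{des O}
R : ∀ {n} → Graph n → Poly
R G k = length (filter (λ o → Data.Bool._≟_ (not (hasCycle G o) ∧ ⌊ des o Data.Nat.≟ k ⌋) true)
                       (orientations G))

invGraph : ∀ {n} → Permutation′ n → Graph n
invGraph w i j = ⌊ i <ᶠ? j ⌋ ∧ ⌊ (w ⟨$⟩ʳ j) <ᶠ? (w ⟨$⟩ʳ i) ⌋

Rw : ∀ {n} → Permutation′ n → Poly
Rw w = R (invGraph w)

-- flat(w,k): delete position k and standardize (stdlib 'remove' does
-- exactly this: j ↦ punchOut (w k) (w (punchIn k j))).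
flat : ∀ {n} → Permutation′ (suc n) → Fin (suc n) → Permutation′ n
flat w k = remove k w

Contains : ∀ {n k} → Permutation′ n → (Fin k → Fin k) → Set
Contains {n} {k} w σ =
  Σ (Fin k → Fin n) λ f →
    (∀ a b → a < b → f a < f b) ×
    (∀ a b → ((w ⟨$⟩ʳ f a) < (w ⟨$⟩ʳ f b)) ⇔ (σ a < σ b))

Avoids : ∀ {n k} → Permutation′ n → (Fin k → Fin k) → Set
Avoids w σ = ¬ Contains w σ

-- the patterns 3412 and 4231 (0-based one-line notation)
f0 f1 f2 f3 : Fin 4
f0 = Fin.zero
f1 = Fin.suc Fin.zero
f2 = Fin.suc (Fin.suc Fin.zero)
f3 = Fin.suc (Fin.suc (Fin.suc Fin.zero))

p3412 : Fin 4 → Fin 4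
p3412 i = lookup (f2 ∷ f3 ∷ f0 ∷ f1 ∷ []) i

p4231 : Fin 4 → Fin 4
p4231 i = lookup (f3 ∷ f1 ∷ f2 ∷ f0 ∷ []) i

module Submission where

-- The factorisation is an instance of a general fact about graphs
-- (VertexDeletion): if the neighbours K of a vertex v form a clique and all
-- lie on one side of v, then R_G = [|K|+1]_q R_{G−v}.  Indeed, for a fixed
-- orientation of G − v the edges at v give an acyclic orientation exactly
-- when the vertices oriented towards v precede those oriented away from v
-- in the tournament on K (ApexCycles), and there is exactly one such
-- choice with j descents for each 0 ≤ j ≤ |K| (SegmentCount).

module BoolFacts where

  open import Defs using (_==ᶠ_)
  open import Data.Nat using (ℕ)
  open import Data.Bool using (Bool; true; false; _∧_; _∨_)
  open import Data.Bool.Properties using (∨-assoc; ∨-zeroʳ)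
  open import Data.Bool.ListAction using (any)
  open import Data.Fin using (Fin; _≟_)
  open import Data.List using ([]; _∷_; _++_)
  open import Data.List.Membership.Propositional using (_∈_)
  open import Data.List.Relation.Unary.Any using (here; there)
  open import Data.Product using (_×_; _,_; Σ)
  open import Data.Sum using (_⊎_; inj₁; inj₂)
  open import Relation.Nullary using (Dec; yes; no; ¬_; ⌊_⌋; contradiction)
  open import Relation.Binary.PropositionalEquality

  𝟙 : Bool → ℕ
  𝟙 true = 1
  𝟙 false = 0

  ∧-true : ∀ {a b} → a ∧ b ≡ true → (a ≡ true) × (b ≡ true)
  ∧-true {true} {true} _ = refl , refl

  true-∧ : ∀ {a b} → a ≡ true → b ≡ true → a ∧ b ≡ true
  true-∧ refl refl = refl

  ∨-true : ∀ {a b} → a ∨ b ≡ true → (a ≡ true) ⊎ (b ≡ true)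
  ∨-true {true} _ = inj₁ refl
  ∨-true {false} h = inj₂ h

  dec-sound : ∀ {P : Set} (d : Dec P) → ⌊ d ⌋ ≡ true → P
  dec-sound (yes p) _ = p

  dec-true : ∀ {P : Set} (d : Dec P) → P → ⌊ d ⌋ ≡ true
  dec-true (yes _) _ = refl
  dec-true (no ¬p) p = contradiction p ¬p

  dec-false : ∀ {P : Set} (d : Dec P) → ¬ P → ⌊ d ⌋ ≡ false
  dec-false (yes p) ¬p = contradiction p ¬p
  dec-false (no _) _ = refl

  ==-sound : ∀ {M} {a b : Fin M} → (a ==ᶠ b) ≡ true → a ≡ b
  ==-sound {a = a} {b} = dec-sound (a ≟ b)

  ==-refl : ∀ {M} (a : Fin M) → (a ==ᶠ a) ≡ true
  ==-refl a = dec-true (a ≟ a) refl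

  ==-false : ∀ {M} {a b : Fin M} → a ≢ b → (a ==ᶠ b) ≡ false
  ==-false {a = a} {b} = dec-false (a ≟ b)

  any-cong : ∀ {A : Set} (p q : A → Bool) → (∀ e → p e ≡ q e) → ∀ xs → any p xs ≡ any q xs
  any-cong p q h [] = refl
  any-cong p q h (x ∷ xs) = cong₂ _∨_ (h x) (any-cong p q h xs)

  any-++ : ∀ {A : Set} (p : A → Bool) xs ys → any p (xs ++ ys) ≡ any p xs ∨ any p ys
  any-++ p [] ys = refl
  any-++ p (x ∷ xs) ys = trans (cong (p x ∨_) (any-++ p xs ys)) (sym (∨-assoc (p x) _ _))

  any-true : ∀ {A : Set} (p : A → Bool) xs → any p xs ≡ true → Σ A λ x → (x ∈ xs) × (p x ≡ true)
  any-true p (x ∷ xs) h with p x in eq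
  ... | true = x , here refl , eq
  ... | false with any-true p xs h
  ...   | y , m , e = y , there m , e

  true-any : ∀ {A : Set} (p : A → Bool) {xs x} → x ∈ xs → p x ≡ true → any p xs ≡ true
  true-any p {y ∷ ys} (here refl) h rewrite h = refl
  true-any p {y ∷ ys} (there m) h rewrite true-any p m h = ∨-zeroʳ (p y)

module BoolListSums where

  -- An orientation of a graph with r edges is a Boolean list of length r,
  -- so R_G(q) is coefficientwise such a sum; these are the algebraic rules
  -- (splitting off the head, linearity, Fubini) used to manipulate it.

  open import Defs using (allBoolLists)
  open BoolFacts using (𝟙)
  open import Data.Nat using (ℕ; zero; suc; _+_; _*_)
  open import Data.Nat.Properties using (+-identityʳ; *-distribˡ-+; +-commutativeSemigroup)
  open import Algebra.Properties.CommutativeSemigroup +-commutativeSemigroup using (interchange)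
  open import Data.Nat.ListAction using (sum)
  open import Data.Nat.ListAction.Properties using (sum-++)
  open import Data.Bool using (Bool; true; false)
  import Data.Bool
  open import Data.List using (List; []; _∷_; map; filter; length; concatMap)
  open import Data.List.Properties using (map-++)
  open import Function using (_∘_)
  open import Relation.Binary.PropositionalEquality
  open ≡-Reasoning

  length-filter≡sum : ∀ {A : Set} (p : A → Bool) xs →
    length (filter (λ x → Data.Bool._≟_ (p x) true) xs) ≡ sum (map (𝟙 ∘ p) xs)
  length-filter≡sum p [] = refl
  length-filter≡sum p (x ∷ xs) with p x
  ... | true = cong suc (length-filter≡sum p xs)
  ... | false = length-filter≡sum p xs

  sum-map-cong : ∀ {A : Set} {f g : A → ℕ} → (∀ x → f x ≡ g x) → ∀ xs → sum (map f xs) ≡ sum (map g xs)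
  sum-map-cong h [] = refl
  sum-map-cong h (x ∷ xs) = cong₂ _+_ (h x) (sum-map-cong h xs)

  sum-map-+ : ∀ {A : Set} (f g : A → ℕ) xs → sum (map (λ x → f x + g x) xs) ≡ sum (map f xs) + sum (map g xs)
  sum-map-+ f g [] = refl
  sum-map-+ f g (x ∷ xs) = begin
    f x + g x + sum (map (λ x → f x + g x) xs)   ≡⟨ cong (f x + g x +_) (sum-map-+ f g xs) ⟩
    f x + g x + (sum (map f xs) + sum (map g xs)) ≡⟨ interchange (f x) (g x) _ _ ⟩
    f x + sum (map f xs) + (g x + sum (map g xs)) ∎

  sum-concatMap : ∀ {A B : Set} (f : B → ℕ) (g : A → List B) xs →
    sum (map f (concatMap g xs)) ≡ sum (map (λ x → sum (map f (g x))) xs)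
  sum-concatMap f g [] = refl
  sum-concatMap f g (x ∷ xs) = begin
    sum (map f (g x Data.List.++ concatMap g xs))        ≡⟨ cong sum (map-++ f (g x) (concatMap g xs)) ⟩
    sum (map f (g x) Data.List.++ map f (concatMap g xs)) ≡⟨ sum-++ (map f (g x)) _ ⟩
    sum (map f (g x)) + sum (map f (concatMap g xs))     ≡⟨ cong (_ +_) (sum-concatMap f g xs) ⟩
    _ ∎

  -- sumBools m f = Σ { f o | o a Boolean list of length m }, defined by
  -- splitting on the first entry.  It is kept opaque so that it is only
  -- ever manipulated through the laws below.
  opaque
    sumBools : ℕ → (List Bool → ℕ) → ℕ
    sumBools zero f = f []
    sumBools (suc m) f = sumBools m (λ bs → f (false ∷ bs)) + sumBools m (λ bs → f (true ∷ bs))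

    sumBools-nil : ∀ f → sumBools 0 f ≡ f []
    sumBools-nil f = refl

    sumBools-suc : ∀ m f → sumBools (suc m) f ≡ sumBools m (λ bs → f (false ∷ bs)) + sumBools m (λ bs → f (true ∷ bs))
    sumBools-suc m f = refl

    sum-allBoolLists : ∀ m f → sum (map f (allBoolLists m)) ≡ sumBools m f
    sum-allBoolLists zero f = +-identityʳ (f [])
    sum-allBoolLists (suc m) f = begin
      sum (map f (allBoolLists (suc m)))
        ≡⟨ sum-concatMap f _ (allBoolLists m) ⟩
      sum (map (λ bs → f (false ∷ bs) + (f (true ∷ bs) + 0)) (allBoolLists m))
        ≡⟨ sum-map-cong (λ bs → cong (f (false ∷ bs) +_) (+-identityʳ _)) (allBoolLists m) ⟩
      sum (map (λ bs → f (false ∷ bs) + f (true ∷ bs)) (allBoolLists m))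
        ≡⟨ sum-map-+ (λ bs → f (false ∷ bs)) (λ bs → f (true ∷ bs)) (allBoolLists m) ⟩
      sum (map (λ bs → f (false ∷ bs)) (allBoolLists m)) + sum (map (λ bs → f (true ∷ bs)) (allBoolLists m))
        ≡⟨ cong₂ _+_ (sum-allBoolLists m _) (sum-allBoolLists m _) ⟩
      sumBools (suc m) f ∎

  sumBools-cong : ∀ m {f g} → (∀ o → length o ≡ m → f o ≡ g o) → sumBools m f ≡ sumBools m g
  sumBools-cong zero {f} {g} h = begin
    sumBools 0 f ≡⟨ sumBools-nil f ⟩
    f []         ≡⟨ h [] refl ⟩
    g []         ≡⟨ sumBools-nil g ⟨
    sumBools 0 g ∎
  sumBools-cong (suc m) {f} {g} h = begin
    sumBools (suc m) f
      ≡⟨ sumBools-suc m f ⟩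
    sumBools m (λ bs → f (false ∷ bs)) + sumBools m (λ bs → f (true ∷ bs))
      ≡⟨ cong₂ _+_ (sumBools-cong m (λ o e → h (false ∷ o) (cong suc e)))
                   (sumBools-cong m (λ o e → h (true ∷ o) (cong suc e))) ⟩
    sumBools m (λ bs → g (false ∷ bs)) + sumBools m (λ bs → g (true ∷ bs))
      ≡⟨ sumBools-suc m g ⟨
    sumBools (suc m) g ∎

  sumBools-0 : ∀ m → sumBools m (λ _ → 0) ≡ 0
  sumBools-0 zero = sumBools-nil _
  sumBools-0 (suc m) = trans (sumBools-suc m _) (cong₂ _+_ (sumBools-0 m) (sumBools-0 m))

  sumBools-+ : ∀ m f g → sumBools m (λ o → f o + g o) ≡ sumBools m f + sumBools m g
  sumBools-+ zero f g = trans (sumBools-nil _) (sym (cong₂ _+_ (sumBools-nil f) (sumBools-nil g)))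
  sumBools-+ (suc m) f g = begin
    sumBools (suc m) (λ o → f o + g o)
      ≡⟨ sumBools-suc m _ ⟩
    sumBools m (λ o → f (false ∷ o) + g (false ∷ o)) + sumBools m (λ o → f (true ∷ o) + g (true ∷ o))
      ≡⟨ cong₂ _+_ (sumBools-+ m _ _) (sumBools-+ m _ _) ⟩
    (F₀ + G₀) + (F₁ + G₁)
      ≡⟨ interchange F₀ G₀ F₁ G₁ ⟩
    (F₀ + F₁) + (G₀ + G₁)
      ≡⟨ cong₂ _+_ (sumBools-suc m f) (sumBools-suc m g) ⟨
    sumBools (suc m) f + sumBools (suc m) g ∎
    where
    F₀ F₁ G₀ G₁ : ℕ
    F₀ = sumBools m (λ o → f (false ∷ o))
    F₁ = sumBools m (λ o → f (true ∷ o))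
    G₀ = sumBools m (λ o → g (false ∷ o))
    G₁ = sumBools m (λ o → g (true ∷ o))

  sumBools-* : ∀ m c f → sumBools m (λ o → c * f o) ≡ c * sumBools m f
  sumBools-* zero c f = trans (sumBools-nil _) (cong (c *_) (sym (sumBools-nil f)))
  sumBools-* (suc m) c f = begin
    sumBools (suc m) (λ o → c * f o)
      ≡⟨ sumBools-suc m _ ⟩
    sumBools m (λ o → c * f (false ∷ o)) + sumBools m (λ o → c * f (true ∷ o))
      ≡⟨ cong₂ _+_ (sumBools-* m c _) (sumBools-* m c _) ⟩
    c * sumBools m (λ o → f (false ∷ o)) + c * sumBools m (λ o → f (true ∷ o))
      ≡⟨ *-distribˡ-+ c _ _ ⟨
    c * (sumBools m (λ o → f (false ∷ o)) + sumBools m (λ o → f (true ∷ o)))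
      ≡⟨ cong (c *_) (sumBools-suc m f) ⟨
    c * sumBools (suc m) f ∎

  sumBools-comm : ∀ a b (f : List Bool → List Bool → ℕ) →
    sumBools a (λ x → sumBools b (λ y → f x y)) ≡ sumBools b (λ y → sumBools a (λ x → f x y))
  sumBools-comm zero b f = begin
    sumBools 0 (λ x → sumBools b (f x))       ≡⟨ sumBools-nil (λ x → sumBools b (f x)) ⟩
    sumBools b (f [])                         ≡⟨ sumBools-cong b (λ o _ → sym (sumBools-nil (λ x → f x o))) ⟩
    sumBools b (λ y → sumBools 0 (λ x → f x y)) ∎
  sumBools-comm (suc a) b f = begin
    sumBools (suc a) (λ x → sumBools b (f x))
      ≡⟨ sumBools-suc a _ ⟩
    sumBools a (λ x → sumBools b (f (false ∷ x))) + sumBools a (λ x → sumBools b (f (true ∷ x)))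
      ≡⟨ cong₂ _+_ (sumBools-comm a b (λ x → f (false ∷ x))) (sumBools-comm a b (λ x → f (true ∷ x))) ⟩
    sumBools b (λ y → sumBools a (λ x → f (false ∷ x) y)) + sumBools b (λ y → sumBools a (λ x → f (true ∷ x) y))
      ≡⟨ sumBools-+ b _ _ ⟨
    sumBools b (λ y → sumBools a (λ x → f (false ∷ x) y) + sumBools a (λ x → f (true ∷ x) y))
      ≡⟨ sumBools-cong b (λ y _ → sym (sumBools-suc a (λ x → f x y))) ⟩
    sumBools b (λ y → sumBools (suc a) (λ x → f x y)) ∎

  sumBools-sum : ∀ {A : Set} m (xs : List A) (g : A → List Bool → ℕ) →
    sumBools m (λ o → sum (map (λ i → g i o) xs)) ≡ sum (map (λ i → sumBools m (g i)) xs)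
  sumBools-sum m [] g = sumBools-0 m
  sumBools-sum m (x ∷ xs) g = trans (sumBools-+ m _ _) (cong (sumBools m (g x) +_) (sumBools-sum m xs g))

module Orientations where

  -- Zipping the two gives a list of labelled edges, and both
  -- acyclicity and the descent number only depend on the *multiset* of
  -- labelled edges.  Hence R_G(q) can be computed after splitting the edge
  -- list into any two interleaved sublists (a "shuffle"), which is the
  -- bookkeeping behind deleting a vertex.

  open import Defs
  open BoolFacts
  open BoolListSums
  open import Data.Nat as ℕ using (ℕ; zero; suc; _+_)
  open import Data.Nat.Properties using (suc-injective; +-assoc; +-comm)
  open import Data.Nat.ListAction using (sum)
  open import Data.Bool using (Bool; true; false; _∧_; _∨_; not)
  import Data.Bool
  open import Data.Bool.Properties using (∨-comm; ∨-assoc)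
  open import Data.Bool.ListAction using (any)
  open import Data.Fin using (Fin)
  open import Data.List using (List; []; _∷_; map; filter; length; _++_; zip; allFin; upTo)
  open import Data.Product using (_×_; _,_; proj₂)
  open import Relation.Nullary using (⌊_⌋)
  open import Relation.Binary.PropositionalEquality
  open import Function using (_∘_)
  open ≡-Reasoning

  LabelledEdges : ℕ → Set
  LabelledEdges M = List ((Fin M × Fin M) × Bool)

  arcOf : ∀ {M} → (Fin M × Fin M) × Bool → Fin M → Fin M → Bool
  arcOf ((i , j) , false) a b = (i ==ᶠ a) ∧ (j ==ᶠ b)
  arcOf ((i , j) , true)  a b = (j ==ᶠ a) ∧ (i ==ᶠ b)

  arcsOf : ∀ {M} → LabelledEdges M → Fin M → Fin M → Bool
  arcsOf Z a b = any (λ e → arcOf e a b) Z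

  walkR : ∀ {M} → (Fin M → Fin M → Bool) → ℕ → Fin M → Fin M → Bool
  walkR A zero a b = a ==ᶠ b
  walkR {M} A (suc ℓ) a b = any (λ c → A a c ∧ walkR A ℓ c b) (allFin M)

  hasCycleR : ∀ {M} → (Fin M → Fin M → Bool) → Bool
  hasCycleR {M} A = any (λ a → any (λ ℓ → walkR A (suc ℓ) a a) (upTo M)) (allFin M)

  walkR-cong : ∀ {M} (A B : Fin M → Fin M → Bool) → (∀ a b → A a b ≡ B a b) →
    ∀ ℓ a b → walkR A ℓ a b ≡ walkR B ℓ a b
  walkR-cong A B h zero a b = refl
  walkR-cong {M} A B h (suc ℓ) a b =
    any-cong _ _ (λ c → cong₂ _∧_ (h a c) (walkR-cong A B h ℓ c b)) (allFin M)

  hasCycleR-cong : ∀ {M} (A B : Fin M → Fin M → Bool) → (∀ a b → A a b ≡ B a b) → hasCycleR A ≡ hasCycleR B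
  hasCycleR-cong {M} A B h = any-cong _ _ (λ a → any-cong _ _ (λ ℓ → walkR-cong A B h (suc ℓ) a a) (upTo M)) (allFin M)

  arc≡ : ∀ {n} (G : Graph n) o a b → arc G o a b ≡ arcsOf (zip (edges G) o) a b
  arc≡ G o a b = any-cong _ _ (λ { ((i , j) , false) → refl ; ((i , j) , true) → refl }) (zip (edges G) o)

  walk≡ : ∀ {n} (G : Graph n) o ℓ a b → walk G o ℓ a b ≡ walkR (arc G o) ℓ a b
  walk≡ G o zero a b = refl
  walk≡ {n} G o (suc ℓ) a b = any-cong _ _ (λ c → cong (arc G o a c ∧_) (walk≡ G o ℓ c b)) (allFin n)

  hasCycle≡ : ∀ {n} (G : Graph n) o → hasCycle G o ≡ hasCycleR (arcsOf (zip (edges G) o))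
  hasCycle≡ {n} G o = trans
    (any-cong _ _ (λ a → any-cong _ _ (λ ℓ → walk≡ G o (suc ℓ) a a) (upTo n)) (allFin n))
    (hasCycleR-cong _ _ (arc≡ G o))

  desOf : ∀ {X : Set} → List (X × Bool) → ℕ
  desOf Z = sum (map (𝟙 ∘ proj₂) Z)

  des≡ : ∀ {X : Set} (E : List X) (o : List Bool) → length o ≡ length E → des o ≡ desOf (zip E o)
  des≡ [] [] _ = refl
  des≡ (x ∷ E) (true ∷ o) h = cong suc (des≡ E o (suc-injective h))
  des≡ (x ∷ E) (false ∷ o) h = des≡ E o (suc-injective h)

  acyclicWithDes : ∀ {M} → ℕ → LabelledEdges M → ℕ
  acyclicWithDes k Z = 𝟙 (not (hasCycleR (arcsOf Z)) ∧ ⌊ desOf Z ℕ.≟ k ⌋)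

  R≡sumBools : ∀ {n} (G : Graph n) k → R G k ≡ sumBools (length (edges G)) (λ o → acyclicWithDes k (zip (edges G) o))
  R≡sumBools G k = trans (length-filter≡sum _ (allBoolLists (length (edges G)))) (trans (sum-allBoolLists _ _)
    (sumBools-cong (length (edges G)) λ o h → cong 𝟙 (cong₂ (λ x y → not x ∧ ⌊ y ℕ.≟ k ⌋) (hasCycle≡ G o) (des≡ (edges G) o h))))

  arcsOf-move : ∀ {M} (U V : LabelledEdges M) y a b → arcsOf (U ++ y ∷ V) a b ≡ arcsOf (y ∷ U ++ V) a b
  arcsOf-move {M} U V y a b = begin
    any p (U ++ y ∷ V) ≡⟨ any-++ p U (y ∷ V) ⟩
    any p U ∨ (p y ∨ any p V) ≡⟨ sym (∨-assoc (any p U) (p y) (any p V)) ⟩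
    (any p U ∨ p y) ∨ any p V ≡⟨ cong (_∨ any p V) (∨-comm (any p U) (p y)) ⟩
    (p y ∨ any p U) ∨ any p V ≡⟨ ∨-assoc (p y) (any p U) (any p V) ⟩
    p y ∨ (any p U ∨ any p V) ≡⟨ cong (p y ∨_) (sym (any-++ p U V)) ⟩
    any p (y ∷ U ++ V) ∎
    where
    p : (Fin M × Fin M) × Bool → Bool
    p e = arcOf e a b

  desOf-++ : ∀ {X : Set} (U V : List (X × Bool)) → desOf (U ++ V) ≡ desOf U + desOf V
  desOf-++ [] V = refl
  desOf-++ ((x , b) ∷ U) V = trans (cong (𝟙 b +_) (desOf-++ U V)) (sym (+-assoc (𝟙 b) _ _))

  desOf-move : ∀ {X : Set} (U V : List (X × Bool)) y → desOf (U ++ y ∷ V) ≡ desOf (y ∷ U ++ V)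
  desOf-move U V (x , b) = begin
    desOf (U ++ (x , b) ∷ V) ≡⟨ desOf-++ U ((x , b) ∷ V) ⟩
    desOf U + (𝟙 b + desOf V) ≡⟨ sym (+-assoc (desOf U) _ _) ⟩
    desOf U + 𝟙 b + desOf V ≡⟨ cong (_+ desOf V) (+-comm (desOf U) (𝟙 b)) ⟩
    𝟙 b + desOf U + desOf V ≡⟨ +-assoc (𝟙 b) _ _ ⟩
    𝟙 b + (desOf U + desOf V) ≡⟨ cong (𝟙 b +_) (sym (desOf-++ U V)) ⟩
    desOf ((x , b) ∷ U ++ V) ∎

  MoveInvariant : {A : Set} → (List A → ℕ) → Set
  MoveInvariant F = ∀ U V y → F (U ++ y ∷ V) ≡ F (y ∷ U ++ V)

  moveInvariant-∷ : {A : Set} {F : List A → ℕ} → MoveInvariant F → ∀ l → MoveInvariant (λ Z → F (l ∷ Z))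
  moveInvariant-∷ inv l U V y = trans (inv (l ∷ U) V y) (sym (inv (l ∷ []) (U ++ V) y))

  acyclicWithDes-move : ∀ {M} k → MoveInvariant (acyclicWithDes {M} k)
  acyclicWithDes-move k U V y = cong₂ (λ x z → 𝟙 (not x ∧ ⌊ z ℕ.≟ k ⌋))
    (hasCycleR-cong _ _ (arcsOf-move U V y)) (desOf-move U V y)

  data Shuffle {X : Set} : List X → List X → List X → Set where
    sh[] : Shuffle [] [] []
    shL : ∀ {x as bs cs} → Shuffle as bs cs → Shuffle (x ∷ as) bs (x ∷ cs)
    shR : ∀ {x as bs cs} → Shuffle as bs cs → Shuffle as (x ∷ bs) (x ∷ cs)

  shuffle-filter : ∀ {X : Set} (p : X → Bool) xs →
    Shuffle (filter (λ x → Data.Bool._≟_ (p x) true) xs) (filter (λ x → Data.Bool._≟_ (not (p x)) true) xs) xs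
  shuffle-filter p [] = sh[]
  shuffle-filter p (x ∷ xs) with p x
  ... | true = shL (shuffle-filter p xs)
  ... | false = shR (shuffle-filter p xs)

  sumBools-shuffle : ∀ {X : Set} {P Q E : List X} → Shuffle P Q E →
    (F : List (X × Bool) → ℕ) → MoveInvariant F →
    sumBools (length E) (λ o → F (zip E o)) ≡ sumBools (length P) (λ op → sumBools (length Q) (λ oq → F (zip P op ++ zip Q oq)))
  sumBools-shuffle sh[] F inv = begin
    sumBools 0 (λ o → F [])                      ≡⟨ sumBools-nil _ ⟩
    F []                                         ≡⟨ sumBools-nil _ ⟨
    sumBools 0 (λ oq → F [])                     ≡⟨ sumBools-nil _ ⟨
    sumBools 0 (λ op → sumBools 0 (λ oq → F [])) ∎
  sumBools-shuffle {P = x ∷ P} {Q} {x ∷ E} (shL sh) F inv = begin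
    sumBools (suc (length E)) (λ o → F (zip (x ∷ E) o))
      ≡⟨ sumBools-suc _ _ ⟩
    sumBools (length E) (λ o → F ((x , false) ∷ zip E o)) + sumBools (length E) (λ o → F ((x , true) ∷ zip E o))
      ≡⟨ cong₂ _+_ (sumBools-shuffle sh (λ Z → F ((x , false) ∷ Z)) (moveInvariant-∷ {F = F} inv (x , false)))
                   (sumBools-shuffle sh (λ Z → F ((x , true) ∷ Z)) (moveInvariant-∷ {F = F} inv (x , true))) ⟩
    _ ≡⟨ sumBools-suc _ _ ⟨
    sumBools (suc (length P)) (λ op → sumBools (length Q) (λ oq → F (zip (x ∷ P) op ++ zip Q oq))) ∎
  sumBools-shuffle {P = P} {x ∷ Q} {x ∷ E} (shR sh) F inv = begin
    sumBools (suc (length E)) (λ o → F (zip (x ∷ E) o))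
      ≡⟨ sumBools-suc _ _ ⟩
    sumBools (length E) (λ o → F ((x , false) ∷ zip E o)) + sumBools (length E) (λ o → F ((x , true) ∷ zip E o))
      ≡⟨ cong₂ _+_ (sumBools-shuffle sh (λ Z → F ((x , false) ∷ Z)) (moveInvariant-∷ {F = F} inv (x , false)))
                   (sumBools-shuffle sh (λ Z → F ((x , true) ∷ Z)) (moveInvariant-∷ {F = F} inv (x , true))) ⟩
    sumBools (length P) (λ op → sumBools (length Q) (λ oq → F ((x , false) ∷ zip P op ++ zip Q oq)))
     + sumBools (length P) (λ op → sumBools (length Q) (λ oq → F ((x , true) ∷ zip P op ++ zip Q oq)))
      ≡⟨ sumBools-+ _ _ _ ⟨
    sumBools (length P) (λ op → sumBools (length Q) (λ oq → F ((x , false) ∷ zip P op ++ zip Q oq))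
                              + sumBools (length Q) (λ oq → F ((x , true) ∷ zip P op ++ zip Q oq)))
      ≡⟨ sumBools-cong (length P) (λ op _ → cong₂ _+_
            (sumBools-cong (length Q) (λ oq _ → sym (inv (zip P op) (zip Q oq) (x , false))))
            (sumBools-cong (length Q) (λ oq _ → sym (inv (zip P op) (zip Q oq) (x , true))))) ⟩
    sumBools (length P) (λ op → sumBools (length Q) (λ oq → F (zip P op ++ (x , false) ∷ zip Q oq))
                              + sumBools (length Q) (λ oq → F (zip P op ++ (x , true) ∷ zip Q oq)))
      ≡⟨ sumBools-cong (length P) (λ op _ → sym (sumBools-suc (length Q) (λ oq → F (zip P op ++ zip (x ∷ Q) oq)))) ⟩
    sumBools (length P) (λ op → sumBools (suc (length Q)) (λ oq → F (zip P op ++ zip (x ∷ Q) oq))) ∎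

module Walks where

  -- The Boolean cycle test of Defs only looks at
  -- closed walks of length ≤ M; by the pigeonhole principle any closed walk
  -- can be shortened to such a one, so "has a cycle" is equivalent to the
  -- existence of an arbitrary closed walk (Cyc A).

  open Orientations using (walkR; hasCycleR)
  open BoolFacts using (∧-true; true-∧; any-true; true-any; ==-sound; ==-refl)
  open import Data.Nat as ℕ using (ℕ; zero; suc; _+_; _∸_; s≤s; _≤_; _<_)
  open import Data.Nat.Properties using (≤-refl; ≤-trans; <⇒≤; ≰⇒>; m∸n≤m)
  open import Data.Bool using (Bool; true)
  open import Data.Fin using (Fin; toℕ)
  open import Data.Fin.Properties using (pigeonhole; toℕ<n)
  open import Data.List using (allFin; upTo)
  open import Data.List.Membership.Propositional.Properties using (∈-allFin; ∈-upTo⁺)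
  open import Data.Product using (_×_; _,_; Σ)
  open import Relation.Nullary using (yes; no)
  open import Relation.Binary.PropositionalEquality

  ∸-suc : ∀ m n → m < n → n ∸ m ≡ suc (n ∸ suc m)
  ∸-suc zero (suc n) _ = refl
  ∸-suc (suc m) (suc n) (s≤s p) = ∸-suc m n p

  module _ {M : ℕ} (A : Fin M → Fin M → Bool) where

    data Walk : ℕ → Fin M → Fin M → Set where
      nil : ∀ {a} → Walk 0 a a
      cons : ∀ {ℓ a b c} → A a c ≡ true → Walk ℓ c b → Walk (suc ℓ) a b

    Cyc : Set
    Cyc = Σ ℕ λ ℓ → Σ (Fin M) λ a → Walk (suc ℓ) a a

    walk→Walk : ∀ ℓ a b → walkR A ℓ a b ≡ true → Walk ℓ a b
    walk→Walk zero a b h rewrite ==-sound h = nil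
    walk→Walk (suc ℓ) a b h with any-true _ (allFin M) h
    ... | c , _ , e with ∧-true e
    ...   | e1 , e2 = cons e1 (walk→Walk ℓ c b e2)

    Walk→walk : ∀ {ℓ a b} → Walk ℓ a b → walkR A ℓ a b ≡ true
    Walk→walk {a = a} nil = ==-refl a
    Walk→walk (cons {c = c'} h W) = true-any _ (∈-allFin c') (true-∧ h (Walk→walk W))

    hasCyc→Cyc : hasCycleR A ≡ true → Cyc
    hasCyc→Cyc h with any-true _ (allFin M) h
    ... | a , _ , e with any-true _ (upTo M) e
    ...   | ℓ , _ , e' = ℓ , a , walk→Walk (suc ℓ) a a e'

    vtx : ∀ {ℓ a b} → Walk ℓ a b → ℕ → Fin M
    vtx {a = a} W zero = a
    vtx {a = a} nil (suc i) = a
    vtx (cons _ W) (suc i) = vtx W i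

    pre : ∀ {ℓ a b} (W : Walk ℓ a b) (j : ℕ) → j ≤ ℓ → Walk j a (vtx W j)
    pre W zero _ = nil
    pre (cons h W) (suc j) (s≤s p) = cons h (pre W j p)

    seg : ∀ {ℓ a b} (W : Walk ℓ a b) (i j : ℕ) → i ≤ j → j ≤ ℓ → Walk (j ∸ i) (vtx W i) (vtx W j)
    seg W zero j _ q = pre W j q
    seg (cons h W) (suc i) (suc j) (s≤s p) (s≤s q) = seg W i j p q

    -- a closed walk of length > M revisits a vertex; cut out the part between
    -- the two visits and repeat ('fuel' bounds the length for termination)
    shortenCycle : ∀ fuel ℓ a → suc ℓ ≤ fuel → Walk (suc ℓ) a a → Σ ℕ λ ℓ' → Σ (Fin M) λ a' → (ℓ' < M) × Walk (suc ℓ') a' a'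
    shortenCycle (suc fuel) ℓ a (s≤s p) W with ℓ ℕ.<? M
    ... | yes lt = ℓ , a , lt , W
    ... | no nlt with pigeonhole (≰⇒> (λ q → nlt q)) (λ k → vtx W (toℕ k))
    ...   | k1 , k2 , k12 , eq = shortenCycle fuel ℓ'' x len W2
      where
      i j : ℕ
      i = toℕ k1
      j = toℕ k2
      j≤ℓ : j ≤ suc ℓ
      j≤ℓ = <⇒≤ (toℕ<n k2)
      ℓ'' : ℕ
      ℓ'' = j ∸ suc i
      x : Fin M
      x = vtx W i
      W1 : Walk (j ∸ i) x (vtx W j)
      W1 = seg W i j (<⇒≤ k12) j≤ℓ
      W2 : Walk (suc ℓ'') x x
      W2 = subst₂ (λ L y → Walk L x y) (∸-suc i j k12) (sym eq) W1
      len : suc ℓ'' ≤ fuel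
      len = ≤-trans (≤-trans (subst (_≤ j) (∸-suc i j k12) (m∸n≤m j i)) (ℕ.s≤s⁻¹ (toℕ<n k2))) p

    Cyc→hasCyc : Cyc → hasCycleR A ≡ true
    Cyc→hasCyc (ℓ , a , W) with shortenCycle (suc ℓ) ℓ a ≤-refl W
    ... | ℓ' , a' , lt , W' = true-any _ (∈-allFin a') (true-any _ (∈-upTo⁺ lt) (Walk→walk W'))

    _++W_ : ∀ {ℓ ℓ' a b c} → Walk ℓ a b → Walk ℓ' b c → Walk (ℓ + ℓ') a c
    nil ++W W' = W'
    cons h W ++W W' = cons h (W ++W W')

  mapW : ∀ {M N} (A : Fin M → Fin M → Bool) (B : Fin N → Fin N → Bool) (f : Fin M → Fin N) →
    (∀ a b → A a b ≡ true → B (f a) (f b) ≡ true) → ∀ {ℓ a b} → Walk A ℓ a b → Walk B ℓ (f a) (f b)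
  mapW A B f h nil = nil
  mapW A B f h (cons e W) = cons (h _ _ e) (mapW A B f h W)

  mapCyc : ∀ {M N} (A : Fin M → Fin M → Bool) (B : Fin N → Fin N → Bool) (f : Fin M → Fin N) →
    (∀ a b → A a b ≡ true → B (f a) (f b) ≡ true) → Cyc A → Cyc B
  mapCyc A B f h (ℓ , a , W) = ℓ , f a , mapW A B f h W

module ApexCycles where

  -- A is an orientation of the
  -- edges avoiding v; the edges at v are oriented v → y for y ∈ Out and
  -- x → v for x ∈ In, and A⁺ = (arcs at v) ∪ A.  If In ∪ Out is a clique of
  -- the underlying graph, then A⁺ is acyclic iff A is acyclic and every
  -- In-vertex points (in A) to every Out-vertex: a cycle through v,
  -- x → v → y, can be shortcut to x → y, and conversely an arc y → x with
  -- x ∈ In, y ∈ Out closes the cycle v → y → x → v.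

  open Orientations using (hasCycleR)
  open Walks
  open BoolFacts using (∨-true)
  open import Data.Nat using (ℕ; suc)
  open import Data.Nat.Properties using (+-comm)
  open import Data.Bool using (Bool; true; false; _∨_)
  open import Data.Bool.Properties using (∨-zeroʳ)
  open import Data.Fin using (Fin; _≟_)
  open import Data.Product using (_×_; _,_; Σ; proj₁; proj₂)
  open import Data.Sum using (_⊎_; inj₁; inj₂)
  open import Relation.Nullary using (yes; no; ¬_)
  open import Relation.Binary.PropositionalEquality
  open import Data.Empty using (⊥-elim)

  module Apex {M : ℕ} (v : Fin M) (A B : Fin M → Fin M → Bool) (In Out : Fin M → Set)
    (A-avoids : ∀ x y → A x y ≡ true → (x ≢ v) × (y ≢ v))
    (B-at : ∀ x y → B x y ≡ true → ((x ≡ v) × Out y) ⊎ ((y ≡ v) × In x))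
    (B-out : ∀ y → Out y → B v y ≡ true)
    (B-in : ∀ x → In x → B x v ≡ true)
    (In≢v : ∀ x → In x → x ≢ v)
    (Out≢v : ∀ x → Out x → x ≢ v) where

    A⁺ : Fin M → Fin M → Bool
    A⁺ x y = B x y ∨ A x y

    -- the condition that makes the apex invisible to cycles
    InsBeforeOuts : Set
    InsBeforeOuts = ∀ b a → In b → Out a → A b a ≡ true

    A→A⁺ : ∀ x y → A x y ≡ true → A⁺ x y ≡ true
    A→A⁺ x y h rewrite h = ∨-zeroʳ (B x y)

    B→A⁺ : ∀ {x y} → B x y ≡ true → A⁺ x y ≡ true
    B→A⁺ h rewrite h = refl

    A⁺→A : ∀ {x y} → x ≢ v → y ≢ v → A⁺ x y ≡ true → A x y ≡ true
    A⁺→A {x} {y} xv yv h with ∨-true {B x y} h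
    ... | inj₂ a = a
    ... | inj₁ b with B-at x y b
    ...   | inj₁ (p , _) = ⊥-elim (xv p)
    ...   | inj₂ (p , _) = ⊥-elim (yv p)

    A⁺→In : ∀ {x} → x ≢ v → A⁺ x v ≡ true → In x
    A⁺→In {x} xv h with ∨-true {B x v} h
    ... | inj₂ a = ⊥-elim (proj₂ (A-avoids _ _ a) refl)
    ... | inj₁ b with B-at x v b
    ...   | inj₁ (p , _) = ⊥-elim (xv p)
    ...   | inj₂ (_ , i) = i

    A⁺→Out : ∀ {y} → A⁺ v y ≡ true → Out y
    A⁺→Out {y} h with ∨-true {B v y} h
    ... | inj₂ a = ⊥-elim (proj₁ (A-avoids _ _ a) refl)
    ... | inj₁ b with B-at v y b
    ...   | inj₁ (_ , o) = o
    ...   | inj₂ (p , i) = ⊥-elim (In≢v v i refl)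

    walk-avoidsApex : ∀ {ℓ c z} → c ≢ v → Walk A ℓ c z → z ≢ v
    walk-avoidsApex cv nil = cv
    walk-avoidsApex cv (cons h W) = walk-avoidsApex (proj₂ (A-avoids _ _ h)) W

    module _ (dc : InsBeforeOuts) where
      -- Follow an A⁺-walk from x ≠ v, replacing each visit x' → v → y by the
      -- A-arc x' → y.  Either the whole walk is replaced, or it ends at v and
      -- the A-walk ends at an In-vertex.
      bypassApex : ∀ {ℓ x y} → x ≢ v → Walk A⁺ ℓ x y →
            Σ (Fin M) λ z → Σ ℕ (λ ℓ' → Walk A ℓ' x z) × ((z ≡ y) ⊎ ((y ≡ v) × In z))
      bypassApex {x = x} xv nil = x , (0 , nil) , inj₁ refl
      bypassApex {x = x} xv (cons {c = c} h W) with c ≟ v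
      ... | no cv with bypassApex cv W
      ...   | z , (ℓ' , W') , r = z , (suc ℓ' , cons (A⁺→A xv cv h) W') , r
      bypassApex {x = x} xv (cons {c = c} h nil) | yes refl = x , (0 , nil) , inj₂ (refl , A⁺→In xv h)
      bypassApex {x = x} xv (cons {c = c} h (cons {c = c'} h' W)) | yes refl with bypassApex (Out≢v c' (A⁺→Out h')) W
      ... | z , (ℓ' , W') , r = z , (suc ℓ' , cons (dc x c' (A⁺→In xv h) (A⁺→Out h')) W') , r

      cycle-avoidApex : Cyc A⁺ → Cyc A
      cycle-avoidApex (ℓ , a , W) with a ≟ v
      cycle-avoidApex (ℓ , a , cons {c = c} h W) | no av with c ≟ v
      ... | no cv with bypassApex cv W
      ...   | z , (ℓ' , W') , inj₁ refl = ℓ' , a , cons (A⁺→A av cv h) W'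
      ...   | z , (ℓ' , W') , inj₂ (p , _) = ⊥-elim (av p)
      cycle-avoidApex (ℓ , a , cons {c = c} h nil) | no av | yes refl = ⊥-elim (av refl)
      cycle-avoidApex (ℓ , a , cons {c = c} h (cons {c = c'} h' W)) | no av | yes refl
        with bypassApex (Out≢v c' (A⁺→Out h')) W
      ... | z , (ℓ' , W') , inj₁ refl = ℓ' , a , cons (dc a c' (A⁺→In av h) (A⁺→Out h')) W'
      ... | z , (ℓ' , W') , inj₂ (p , _) = ⊥-elim (av p)
      cycle-avoidApex (ℓ , a , cons {c = c} h W) | yes refl with bypassApex (Out≢v c (A⁺→Out h)) W
      ... | z , (ℓ' , W') , inj₁ refl = ⊥-elim (walk-avoidsApex (Out≢v c (A⁺→Out h)) W' refl)
      ... | z , (ℓ' , W') , inj₂ (_ , iz) =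
        ℓ' , c , subst (λ L → Walk A L c c) (+-comm ℓ' 1) (_++W_ A W' (cons (dc z c iz (A⁺→Out h)) nil))

    cycle-withApex : Cyc A → Cyc A⁺
    cycle-withApex = mapCyc A A⁺ (λ x → x) A→A⁺

    module _ (clique : ∀ x y → (In x ⊎ Out x) → (In y ⊎ Out y) → x ≢ y → (A x y ≡ true) ⊎ (A y x ≡ true)) where
      acyclic⇒InsBeforeOuts : ¬ Cyc A⁺ → InsBeforeOuts
      acyclic⇒InsBeforeOuts ac b a ib oa with a ≟ b
      ... | yes refl = ⊥-elim (ac (1 , b , cons (B→A⁺ (B-in b ib)) (cons (B→A⁺ (B-out b oa)) nil)))
      ... | no ab with clique b a (inj₁ ib) (inj₂ oa) (λ e → ab (sym e))
      ...   | inj₁ h = h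
      ...   | inj₂ h = ⊥-elim (ac (2 , v , cons (B→A⁺ (B-out a oa)) (cons (A→A⁺ a b h) (cons (B→A⁺ (B-in b ib)) nil))))

      acyclic⇒split : hasCycleR A⁺ ≡ false → (hasCycleR A ≡ false) × InsBeforeOuts
      acyclic⇒split h = hA , acyclic⇒InsBeforeOuts ¬cyc
        where
        ¬cyc : ¬ Cyc A⁺
        ¬cyc c with trans (sym (Cyc→hasCyc A⁺ c)) h
        ... | ()
        hA : hasCycleR A ≡ false
        hA with hasCycleR A in e
        ... | false = refl
        ... | true = ⊥-elim (¬cyc (cycle-withApex (hasCyc→Cyc A e)))

    split⇒acyclic : hasCycleR A ≡ false → InsBeforeOuts → hasCycleR A⁺ ≡ false
    split⇒acyclic hA dc with hasCycleR A⁺ in e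
    ... | false = refl
    ... | true with trans (sym (Cyc→hasCyc A (cycle-avoidApex dc (hasCyc→Cyc A⁺ e)))) hA
    ...   | ()

module SegmentCount where

  -- Let T be a strict total order on a list K of distinct elements.  Call a
  -- labelling b ∈ Bool^K a *segment* if every element labelled true comes
  -- before (in T) every element labelled false.  Segments are initial
  -- segments of the order, so for each t there is exactly one segment with
  -- t trues if t ≤ |K|, and none otherwise (segmentCount).
  -- Proof by induction on K = x ∷ K': a segment of x ∷ K' labels x false
  -- iff its restriction to K' is a segment contained in the set of
  -- predecessors of x (itself a segment with p elements), and labels x true
  -- iff the restriction contains it.  Since segments of K' are nested, this
  -- gives [t ≤ p] + [p < t ≤ |K'| + 1] = [t ≤ |K'| + 1].

  open BoolFacts using (𝟙; ∧-true; true-∧; dec-sound)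
  open BoolListSums
  open import Data.Nat as ℕ using (ℕ; zero; suc; _+_; _≤_; _<_; z≤n; s≤s; _≤?_)
  open import Data.Nat.Properties using (suc-injective; m≤n⇒m≤1+n; <-irrefl; <-≤-trans; ≤-trans; <⇒≤; ≰⇒>)
  open import Data.Bool using (Bool; true; false; _∧_; not)
  open import Data.List using (List; []; _∷_; map; length; zip)
  open import Data.List.Properties using (length-map)
  open import Data.Nat.ListAction using (sum)
  open import Data.List.Membership.Propositional using (_∈_)
  open import Data.List.Relation.Unary.Any using (here; there)
  open import Data.List.Relation.Unary.All using (All; []; _∷_)
  open import Data.List.Relation.Unary.Unique.Propositional using (Unique)
  open import Data.List.Relation.Unary.AllPairs using ([]; _∷_)
  open import Data.Product using (_,_; proj₁; proj₂)
  open import Data.Sum using (_⊎_; inj₁; inj₂)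
  open import Relation.Nullary using (yes; no; ¬_; ⌊_⌋)
  open import Relation.Binary.PropositionalEquality
  open import Data.Empty using (⊥; ⊥-elim)
  open import Function using (_∘_; case_of_)

  countTrue : List Bool → ℕ
  countTrue b = sum (map 𝟙 b)

  ⊆ᵇ : List Bool → List Bool → Bool
  ⊆ᵇ [] _ = true
  ⊆ᵇ (_ ∷ _) [] = true
  ⊆ᵇ (true ∷ b) (c ∷ cs) = c ∧ ⊆ᵇ b cs
  ⊆ᵇ (false ∷ b) (_ ∷ cs) = ⊆ᵇ b cs

  ≟-suc : ∀ a b → ⌊ suc a ℕ.≟ suc b ⌋ ≡ ⌊ a ℕ.≟ b ⌋
  ≟-suc a b with a ℕ.≟ b | suc a ℕ.≟ suc b
  ... | yes p | yes q = refl
  ... | no p | no q = refl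
  ... | yes p | no q = ⊥-elim (q (cong suc p))
  ... | no p | yes q = ⊥-elim (p (suc-injective q))

  ⊆ᵇ-count : ∀ b c → length b ≡ length c → ⊆ᵇ b c ≡ true → countTrue b ≤ countTrue c
  ⊆ᵇ-count [] [] _ _ = z≤n
  ⊆ᵇ-count (true ∷ b) (true ∷ c) e h = s≤s (⊆ᵇ-count b c (suc-injective e) h)
  ⊆ᵇ-count (false ∷ b) (true ∷ c) e h = m≤n⇒m≤1+n (⊆ᵇ-count b c (suc-injective e) h)
  ⊆ᵇ-count (false ∷ b) (false ∷ c) e h = ⊆ᵇ-count b c (suc-injective e) h

  ⊆ᵇ-flip : ∀ b c → length b ≡ length c → ⊆ᵇ b c ≡ true → countTrue c ≤ countTrue b → ⊆ᵇ c b ≡ true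
  ⊆ᵇ-flip [] [] _ _ _ = refl
  ⊆ᵇ-flip (true ∷ b) (true ∷ c) e h q = ⊆ᵇ-flip b c (suc-injective e) h (ℕ.s≤s⁻¹ q)
  ⊆ᵇ-flip (false ∷ b) (false ∷ c) e h q = ⊆ᵇ-flip b c (suc-injective e) h q
  ⊆ᵇ-flip (false ∷ b) (true ∷ c) e h q =
    ⊥-elim (<-irrefl refl (<-≤-trans (s≤s (⊆ᵇ-count b c (suc-injective e) h)) q))

  countTrue≤length : ∀ b → countTrue b ≤ length b
  countTrue≤length [] = z≤n
  countTrue≤length (true ∷ b) = s≤s (countTrue≤length b)
  countTrue≤length (false ∷ b) = m≤n⇒m≤1+n (countTrue≤length b)

  𝟙-drop : ∀ a d e → (d ≡ true → e ≡ true → a ≡ true) → 𝟙 ((a ∧ d) ∧ e) ≡ 𝟙 (d ∧ e)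
  𝟙-drop true d e h = refl
  𝟙-drop false true true h with h refl refl
  ... | ()
  𝟙-drop false true false h = refl
  𝟙-drop false false e h = refl

  𝟙-never : ∀ a d e → (a ≡ true → d ≡ true → e ≡ true → ⊥) → 𝟙 ((a ∧ d) ∧ e) ≡ 0
  𝟙-never true true true h = ⊥-elim (h refl refl refl)
  𝟙-never true true false h = refl
  𝟙-never true false e h = refl
  𝟙-never false d e h = refl

  𝟙-≤ : ∀ {a b} → a ≤ b → 𝟙 ⌊ a ≤? b ⌋ ≡ 1
  𝟙-≤ {a} {b} h with a ≤? b
  ... | yes _ = refl
  ... | no q = ⊥-elim (q h)

  𝟙-≰ : ∀ {a b} → ¬ a ≤ b → 𝟙 ⌊ a ≤? b ⌋ ≡ 0
  𝟙-≰ {a} {b} h with a ≤? b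
  ... | yes q = ⊥-elim (h q)
  ... | no q = refl

  -- [p < t ≤ m + 1], the number of segments labelling the head true
  upperWindow : ℕ → ℕ → ℕ → ℕ
  upperWindow p m zero = 0
  upperWindow p m (suc s) = 𝟙 (⌊ p ≤? s ⌋ ∧ ⌊ s ≤? m ⌋)

  window-split : ∀ t p m → p ≤ m → 𝟙 ⌊ t ≤? p ⌋ + upperWindow p m t ≡ 𝟙 ⌊ t ≤? suc m ⌋
  window-split zero p m pm = refl
  window-split (suc s) p m pm with suc s ≤? p | p ≤? s
  ... | yes sp | yes ps = ⊥-elim (<-irrefl refl (<-≤-trans sp ps))
  ... | yes sp | no _ with s ≤? m
  ...   | yes q = sym (𝟙-≤ (s≤s q))
  ...   | no q = ⊥-elim (q (≤-trans (<⇒≤ sp) pm))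
  window-split (suc s) p m pm | no sp | yes ps with s ≤? m
  ...   | yes q = sym (𝟙-≤ (s≤s q))
  ...   | no q = sym (𝟙-≰ (λ r → q (ℕ.s≤s⁻¹ r)))
  window-split (suc s) p m pm | no sp | no ps = ⊥-elim (sp (≰⇒> ps))

  module _ {V : Set} (T : V → V → Bool) where

    beforeAllFalse : V → List V → List Bool → Bool
    beforeAllFalse x [] _ = true
    beforeAllFalse x (y ∷ K) [] = true
    beforeAllFalse x (y ∷ K) (false ∷ b) = T x y ∧ beforeAllFalse x K b
    beforeAllFalse x (y ∷ K) (true ∷ b) = beforeAllFalse x K b

    afterAllTrue : V → List V → List Bool → Bool
    afterAllTrue x [] _ = true
    afterAllTrue x (y ∷ K) [] = true
    afterAllTrue x (y ∷ K) (true ∷ b) = T y x ∧ afterAllTrue x K b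
    afterAllTrue x (y ∷ K) (false ∷ b) = afterAllTrue x K b

    isSegment : List V → List Bool → Bool
    isSegment [] _ = true
    isSegment (x ∷ K) [] = true
    isSegment (x ∷ K) (true ∷ b) = beforeAllFalse x K b ∧ isSegment K b
    isSegment (x ∷ K) (false ∷ b) = afterAllTrue x K b ∧ isSegment K b

    SegmentCount : List V → ℕ → ℕ
    SegmentCount K t = sumBools (length K) (λ b → 𝟙 (isSegment K b ∧ ⌊ countTrue b ℕ.≟ t ⌋))


    predecessors : V → List V → List Bool
    predecessors x K = map (λ y → T y x) K

    afterAllTrue≡ : ∀ x K b → afterAllTrue x K b ≡ ⊆ᵇ b (predecessors x K)
    afterAllTrue≡ x [] [] = refl
    afterAllTrue≡ x [] (_ ∷ _) = refl
    afterAllTrue≡ x (y ∷ K) [] = refl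
    afterAllTrue≡ x (y ∷ K) (true ∷ b) = cong (T y x ∧_) (afterAllTrue≡ x K b)
    afterAllTrue≡ x (y ∷ K) (false ∷ b) = afterAllTrue≡ x K b

    beforeAllFalse≡ : ∀ x K b → length b ≡ length K → All (λ y → T x y ≡ not (T y x)) K →
      beforeAllFalse x K b ≡ ⊆ᵇ (predecessors x K) b
    beforeAllFalse≡ x [] [] _ _ = refl
    beforeAllFalse≡ x (y ∷ K) (true ∷ b) e (h ∷ hs) with T y x
    ... | true = beforeAllFalse≡ x K b (suc-injective e) hs
    ... | false = beforeAllFalse≡ x K b (suc-injective e) hs
    beforeAllFalse≡ x (y ∷ K) (false ∷ b) e (h ∷ hs) rewrite h with T y x
    ... | true = refl
    ... | false = beforeAllFalse≡ x K b (suc-injective e) hs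

    IsSegment : List V → List Bool → Set
    IsSegment K b = ∀ x y → (x , true) ∈ zip K b → (y , false) ∈ zip K b → T x y ≡ true

    beforeAllFalse-sound : ∀ x K b → beforeAllFalse x K b ≡ true → ∀ y → (y , false) ∈ zip K b → T x y ≡ true
    beforeAllFalse-sound x (z ∷ K) (false ∷ b) h y (here refl) = proj₁ (∧-true h)
    beforeAllFalse-sound x (z ∷ K) (false ∷ b) h y (there m) = beforeAllFalse-sound x K b (proj₂ (∧-true h)) y m
    beforeAllFalse-sound x (z ∷ K) (true ∷ b) h y (there m) = beforeAllFalse-sound x K b h y m

    afterAllTrue-sound : ∀ y K b → afterAllTrue y K b ≡ true → ∀ x → (x , true) ∈ zip K b → T x y ≡ true
    afterAllTrue-sound y (z ∷ K) (true ∷ b) h x (here refl) = proj₁ (∧-true h)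
    afterAllTrue-sound y (z ∷ K) (true ∷ b) h x (there m) = afterAllTrue-sound y K b (proj₂ (∧-true h)) x m
    afterAllTrue-sound y (z ∷ K) (false ∷ b) h x (there m) = afterAllTrue-sound y K b h x m

    beforeAllFalse-complete : ∀ x K b → (∀ y → (y , false) ∈ zip K b → T x y ≡ true) → beforeAllFalse x K b ≡ true
    beforeAllFalse-complete x [] b h = refl
    beforeAllFalse-complete x (z ∷ K) [] h = refl
    beforeAllFalse-complete x (z ∷ K) (false ∷ b) h =
      true-∧ (h z (here refl)) (beforeAllFalse-complete x K b (λ y m → h y (there m)))
    beforeAllFalse-complete x (z ∷ K) (true ∷ b) h = beforeAllFalse-complete x K b (λ y m → h y (there m))

    afterAllTrue-complete : ∀ y K b → (∀ x → (x , true) ∈ zip K b → T x y ≡ true) → afterAllTrue y K b ≡ true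
    afterAllTrue-complete y [] b h = refl
    afterAllTrue-complete y (z ∷ K) [] h = refl
    afterAllTrue-complete y (z ∷ K) (true ∷ b) h =
      true-∧ (h z (here refl)) (afterAllTrue-complete y K b (λ x m → h x (there m)))
    afterAllTrue-complete y (z ∷ K) (false ∷ b) h = afterAllTrue-complete y K b (λ x m → h x (there m))

    isSegment-sound : ∀ K b → isSegment K b ≡ true → IsSegment K b
    isSegment-sound (z ∷ K) (true ∷ b) h x y (here refl) (there m) = beforeAllFalse-sound z K b (proj₁ (∧-true h)) y m
    isSegment-sound (z ∷ K) (true ∷ b) h x y (there m) (there m') = isSegment-sound K b (proj₂ (∧-true h)) x y m m'
    isSegment-sound (z ∷ K) (false ∷ b) h x y (there m) (here refl) = afterAllTrue-sound z K b (proj₁ (∧-true h)) x m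
    isSegment-sound (z ∷ K) (false ∷ b) h x y (there m) (there m') = isSegment-sound K b (proj₂ (∧-true h)) x y m m'

    isSegment-complete : ∀ K b → IsSegment K b → isSegment K b ≡ true
    isSegment-complete [] b h = refl
    isSegment-complete (z ∷ K) [] h = refl
    isSegment-complete (z ∷ K) (true ∷ b) h =
      true-∧ (beforeAllFalse-complete z K b (λ y m → h z y (here refl) (there m)))
             (isSegment-complete K b (λ x y m m' → h x y (there m) (there m')))
    isSegment-complete (z ∷ K) (false ∷ b) h =
      true-∧ (afterAllTrue-complete z K b (λ x m → h x z (there m) (here refl)))
             (isSegment-complete K b (λ x y m m' → h x y (there m) (there m')))

    module StrictTotal (K₀ : List V)
      (asym : ∀ {x y} → x ∈ K₀ → y ∈ K₀ → T x y ≡ true → T y x ≡ true → ⊥)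
      (tot : ∀ {x y} → x ∈ K₀ → y ∈ K₀ → x ≢ y → (T x y ≡ true) ⊎ (T y x ≡ true))
      (tr : ∀ {x y z} → x ∈ K₀ → y ∈ K₀ → z ∈ K₀ → T x y ≡ true → T y z ≡ true → T x z ≡ true) where

      Sub : List V → Set
      Sub K = ∀ {y} → y ∈ K → y ∈ K₀

      segments-nested-step : ∀ x K b₁ b₂ → x ∈ K₀ → Sub K → length b₁ ≡ length K → length b₂ ≡ length K →
        beforeAllFalse x K b₁ ≡ true → afterAllTrue x K b₂ ≡ true → ⊆ᵇ b₂ b₁ ≡ true
      segments-nested-step x [] [] [] _ _ _ _ _ _ = refl
      segments-nested-step x (y ∷ K) (c₁ ∷ b₁) (c₂ ∷ b₂) xK s e₁ e₂ h₁ h₂ with c₁ | c₂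
      ... | true | true = segments-nested-step x K b₁ b₂ xK (s ∘ there) (suc-injective e₁) (suc-injective e₂) h₁ (proj₂ (∧-true h₂))
      ... | true | false = segments-nested-step x K b₁ b₂ xK (s ∘ there) (suc-injective e₁) (suc-injective e₂) h₁ h₂
      ... | false | false = segments-nested-step x K b₁ b₂ xK (s ∘ there) (suc-injective e₁) (suc-injective e₂) (proj₂ (∧-true h₁)) h₂
      ... | false | true = ⊥-elim (asym xK (s (here refl)) (proj₁ (∧-true h₁)) (proj₁ (∧-true h₂)))

      segments-nested : ∀ K b₁ b₂ → Sub K → length b₁ ≡ length K → length b₂ ≡ length K →
        isSegment K b₁ ≡ true → isSegment K b₂ ≡ true → (⊆ᵇ b₁ b₂ ≡ true) ⊎ (⊆ᵇ b₂ b₁ ≡ true)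
      segments-nested [] [] [] _ _ _ _ _ = inj₁ refl
      segments-nested (x ∷ K) (true ∷ b₁) (true ∷ b₂) s e₁ e₂ h₁ h₂ =
        segments-nested K b₁ b₂ (s ∘ there) (suc-injective e₁) (suc-injective e₂) (proj₂ (∧-true h₁)) (proj₂ (∧-true h₂))
      segments-nested (x ∷ K) (false ∷ b₁) (false ∷ b₂) s e₁ e₂ h₁ h₂ =
        segments-nested K b₁ b₂ (s ∘ there) (suc-injective e₁) (suc-injective e₂) (proj₂ (∧-true h₁)) (proj₂ (∧-true h₂))
      segments-nested (x ∷ K) (true ∷ b₁) (false ∷ b₂) s e₁ e₂ h₁ h₂ =
        inj₂ (segments-nested-step x K b₁ b₂ (s (here refl)) (s ∘ there) (suc-injective e₁) (suc-injective e₂) (proj₁ (∧-true h₁)) (proj₁ (∧-true h₂)))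
      segments-nested (x ∷ K) (false ∷ b₁) (true ∷ b₂) s e₁ e₂ h₁ h₂ =
        inj₁ (segments-nested-step x K b₂ b₁ (s (here refl)) (s ∘ there) (suc-injective e₂) (suc-injective e₁) (proj₁ (∧-true h₂)) (proj₁ (∧-true h₁)))

      predecessor-beforeAllFalse : ∀ x y L → x ∈ K₀ → y ∈ K₀ → Sub L → All (λ z → ¬ x ≡ z) L → T y x ≡ true →
        beforeAllFalse y L (predecessors x L) ≡ true
      predecessor-beforeAllFalse x y [] xK yK s a h = refl
      predecessor-beforeAllFalse x y (z ∷ L) xK yK s (az ∷ a) h with T z x in e
      ... | true = predecessor-beforeAllFalse x y L xK yK (s ∘ there) a h
      ... | false with tot (s (here refl)) xK (λ q → az (sym q))
      ...   | inj₁ zx = ⊥-elim (case trans (sym zx) e of λ ())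
      ...   | inj₂ xz rewrite tr yK xK (s (here refl)) h xz = predecessor-beforeAllFalse x y L xK yK (s ∘ there) a h

      nonPredecessor-afterAllTrue : ∀ x y L → x ∈ K₀ → y ∈ K₀ → y ≢ x → Sub L → T y x ≡ false →
        afterAllTrue y L (predecessors x L) ≡ true
      nonPredecessor-afterAllTrue x y [] xK yK yx s h = refl
      nonPredecessor-afterAllTrue x y (z ∷ L) xK yK yx s h with T z x in e
      ... | false = nonPredecessor-afterAllTrue x y L xK yK yx (s ∘ there) h
      ... | true with tot yK xK yx
      ...   | inj₁ q = ⊥-elim (case trans (sym q) h of λ ())
      ...   | inj₂ xy rewrite tr (s (here refl)) xK yK e xy = nonPredecessor-afterAllTrue x y L xK yK yx (s ∘ there) h

      predecessors-segment : ∀ x L → x ∈ K₀ → Sub L → All (λ z → ¬ x ≡ z) L → isSegment L (predecessors x L) ≡ true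
      predecessors-segment x [] xK s a = refl
      predecessors-segment x (y ∷ L) xK s (ay ∷ a) with T y x in e
      ... | true rewrite predecessor-beforeAllFalse x y L xK (s (here refl)) (s ∘ there) a e =
        predecessors-segment x L xK (s ∘ there) a
      ... | false rewrite nonPredecessor-afterAllTrue x y L xK (s (here refl)) (λ q → ay (sym q)) (s ∘ there) e =
        predecessors-segment x L xK (s ∘ there) a

      T-flip : ∀ x K → x ∈ K₀ → Sub K → All (λ z → ¬ x ≡ z) K → All (λ y → T x y ≡ not (T y x)) K
      T-flip x [] xK s a = []
      T-flip x (y ∷ K) xK s (ay ∷ a) = flip₁ ∷ T-flip x K xK (s ∘ there) a
        where
        yK : y ∈ K₀
        yK = s (here refl)
        flip₁ : T x y ≡ not (T y x)
        flip₁ with T x y in e₁ | T y x in e₂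
        ... | true | true = ⊥-elim (asym xK yK e₁ e₂)
        ... | true | false = refl
        ... | false | true = refl
        ... | false | false with tot xK yK ay
        ...   | inj₁ q = ⊥-elim (case trans (sym q) e₁ of λ ())
        ...   | inj₂ q = ⊥-elim (case trans (sym q) e₂ of λ ())

      -- The induction step, for K = x ∷ K' (written K below) with p the
      -- number of predecessors of x in K.
      module Step (x : V) (K : List V) (xK : x ∈ K₀) (sK : Sub K) (x∉K : All (λ z → ¬ x ≡ z) K)
        (IH : ∀ t → SegmentCount K t ≡ 𝟙 ⌊ t ≤? length K ⌋) where

        m : ℕ
        m = length K

        pred : List Bool
        pred = predecessors x K

        p : ℕ
        p = countTrue pred

        length-pred : length pred ≡ m
        length-pred = length-map (λ y → T y x) K

        p≤m : p ≤ m
        p≤m = subst (p ≤_) length-pred (countTrue≤length pred)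

        pred-segment : isSegment K pred ≡ true
        pred-segment = predecessors-segment x K xK sK x∉K

        ⊆pred : ∀ b → length b ≡ m → isSegment K b ≡ true → countTrue b ≤ p → ⊆ᵇ b pred ≡ true
        ⊆pred b e seg c with segments-nested K b pred sK e length-pred seg pred-segment
        ... | inj₁ h = h
        ... | inj₂ h = ⊆ᵇ-flip pred b (trans length-pred (sym e)) h c

        pred⊆ : ∀ b → length b ≡ m → isSegment K b ≡ true → p ≤ countTrue b → ⊆ᵇ pred b ≡ true
        pred⊆ b e seg c with segments-nested K b pred sK e length-pred seg pred-segment
        ... | inj₂ h = h
        ... | inj₁ h = ⊆ᵇ-flip b pred (trans e (sym length-pred)) h c

        -- segments labelling x false: those of K inside 'pred'
        headFalse : ∀ t → sumBools m (λ b → 𝟙 ((afterAllTrue x K b ∧ isSegment K b) ∧ ⌊ countTrue b ℕ.≟ t ⌋))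
                          ≡ 𝟙 ⌊ t ≤? p ⌋
        headFalse t with t ≤? p
        ... | yes tp = trans (sumBools-cong m (λ b e → 𝟙-drop _ _ _ (λ seg q →
                               trans (afterAllTrue≡ x K b) (⊆pred b e seg (subst (_≤ p) (sym (dec-sound (_ ℕ.≟ t) q)) tp)))))
                             (trans (IH t) (𝟙-≤ (≤-trans tp p≤m)))
        ... | no tp = trans (sumBools-cong m (λ b e → 𝟙-never _ _ _ (λ a _ q →
                              tp (subst (_≤ p) (dec-sound (_ ℕ.≟ t) q)
                                 (⊆ᵇ-count b pred (trans e (sym length-pred)) (trans (sym (afterAllTrue≡ x K b)) a))))))
                            (sumBools-0 m)

        -- segments labelling x true: those of K containing 'pred'
        headTrue : ∀ t → sumBools m (λ b → 𝟙 ((beforeAllFalse x K b ∧ isSegment K b) ∧ ⌊ suc (countTrue b) ℕ.≟ t ⌋))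
                         ≡ upperWindow p m t
        headTrue zero = trans (sumBools-cong m (λ b e → 𝟙-never (beforeAllFalse x K b) (isSegment K b) _ (λ _ _ ()))) (sumBools-0 m)
        headTrue (suc s) with p ≤? s
        ... | yes ps = trans (sumBools-cong m (λ b e → trans
                               (𝟙-drop _ _ _ (λ seg q → trans (beforeAllFalse≡ x K b e flips)
                                 (pred⊆ b e seg (subst (p ≤_) (sym (suc-injective (dec-sound (_ ℕ.≟ suc s) q))) ps))))
                               (cong (λ z → 𝟙 (isSegment K b ∧ z)) (≟-suc (countTrue b) s))))
                             (IH s)
          where
          flips : All (λ y → T x y ≡ not (T y x)) K
          flips = T-flip x K xK sK x∉K
        ... | no ps = trans (sumBools-cong m (λ b e → 𝟙-never _ _ _ (λ a _ q →
                              ps (subst (p ≤_) (suc-injective (dec-sound (_ ℕ.≟ suc s) q))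
                                 (⊆ᵇ-count pred b (trans length-pred (sym e))
                                   (trans (sym (beforeAllFalse≡ x K b e (T-flip x K xK sK x∉K))) a))))))
                            (sumBools-0 m)

      segmentCount : ∀ K → Sub K → Unique K → ∀ t → SegmentCount K t ≡ 𝟙 ⌊ t ≤? length K ⌋
      segmentCount [] s u zero = sumBools-nil _
      segmentCount [] s u (suc t) = sumBools-nil _
      segmentCount (x ∷ K) s (x∉K ∷ uK) t = begin
        SegmentCount (x ∷ K) t
          ≡⟨ sumBools-suc (length K) _ ⟩
        sumBools (length K) (λ b → 𝟙 ((afterAllTrue x K b ∧ isSegment K b) ∧ ⌊ countTrue b ℕ.≟ t ⌋))
          + sumBools (length K) (λ b → 𝟙 ((beforeAllFalse x K b ∧ isSegment K b) ∧ ⌊ suc (countTrue b) ℕ.≟ t ⌋))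
          ≡⟨ cong₂ _+_ (headFalse t) (headTrue t) ⟩
        𝟙 ⌊ t ≤? p ⌋ + upperWindow p (length K) t
          ≡⟨ window-split t p (length K) p≤m ⟩
        𝟙 ⌊ t ≤? suc (length K) ⌋ ∎
        where
        open ≡-Reasoning
        open Step x K (s (here refl)) (s ∘ there) x∉K (segmentCount K (s ∘ there) uK)

module ApexSum where

  -- Fix a vertex v whose
  -- neighbours K form a clique of G − v, and suppose all edges at v point
  -- the same way in the vertex order ('dir' = false: v is smaller than all
  -- of K, dir = true: larger).  For a fixed orientation Z of G − v, sum over
  -- the 2^|K| orientations of the edges at v.  By ApexCycles the result is
  -- acyclic iff Z is and the labelling is a segment for the order Z induces
  -- on K (a tournament, transitive when Z is acyclic); by SegmentCount there
  -- is exactly one such labelling with j descents for each 0 ≤ j ≤ |K|.  So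
  --   Σ_ov [Z + ov acyclic with k descents] = [Z acyclic]·[0 ≤ k − des Z ≤ |K|].

  open import Defs
  open BoolFacts
  open BoolListSums
  open Orientations
  open Walks
  open SegmentCount
  open ApexCycles using (module Apex)
  open import Data.Nat as ℕ using (ℕ; _+_; _*_; _∸_; _≤_; _≤?_)
  open import Data.Nat.Properties using (+-identityʳ; m+n∸n≡m; m∸n+n≡m; m≤n+m)
  open import Data.Bool using (Bool; true; false; _∧_; not)
  open import Data.Bool.Properties using (∧-zeroʳ)
  open import Data.Fin using (Fin; _≟_)
  open import Data.List using (List; _∷_; map; length; zip; _++_)
  open import Data.List.Properties using (length-map)
  open import Data.List.Membership.Propositional using (_∈_)
  open import Data.List.Relation.Unary.Any using (here; there)
  open import Data.List.Relation.Unary.Unique.Propositional using (Unique)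
  open import Data.Product using (_×_; _,_; proj₂)
  open import Data.Sum using (_⊎_; inj₁; inj₂)
  open import Relation.Nullary using (yes; no; ¬_; ⌊_⌋)
  open import Relation.Binary.PropositionalEquality
  open import Data.Empty using (⊥; ⊥-elim)
  open import Function using (flip)

  edgeAt : ∀ {M} → Bool → Fin M → Fin M → Fin M × Fin M
  edgeAt false v k = (v , k)
  edgeAt true v k = (k , v)

  -- the order on K in which segments are counted
  orderAt : ∀ {M} → Bool → (Fin M → Fin M → Bool) → Fin M → Fin M → Bool
  orderAt false A = A
  orderAt true A = flip A

  windowInd : ℕ → ℕ → ℕ → ℕ
  windowInd k m j = 𝟙 (⌊ j ≤? k ⌋ ∧ ⌊ k ∸ j ≤? m ⌋)

  zip-fst : ∀ {X : Set} {K : List X} {o : List Bool} {x c} → (x , c) ∈ zip K o → x ∈ K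
  zip-fst {K = k ∷ K} {c' ∷ o} (here refl) = here refl
  zip-fst {K = k ∷ K} {c' ∷ o} (there m) = there (zip-fst m)

  zip-map-mem : ∀ {X Y : Set} (f : X → Y) {K : List X} {o : List Bool} {x c} →
    (x , c) ∈ zip K o → (f x , c) ∈ zip (map f K) o
  zip-map-mem f {k ∷ K} {c' ∷ o} (here refl) = here refl
  zip-map-mem f {k ∷ K} {c' ∷ o} (there m) = there (zip-map-mem f m)

  countTrue≡desOf : ∀ {X : Set} (E : List X) (o : List Bool) → length o ≡ length E → countTrue o ≡ desOf (zip E o)
  countTrue≡desOf E o h = trans (sym (length-filter≡sum (λ b → b) o)) (des≡ E o h)

  ≟-+ : ∀ c j k → j ≤ k → ⌊ c + j ℕ.≟ k ⌋ ≡ ⌊ c ℕ.≟ k ∸ j ⌋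
  ≟-+ c j k jk with c + j ℕ.≟ k | c ℕ.≟ k ∸ j
  ... | yes p | yes q = refl
  ... | no p | no q = refl
  ... | yes p | no q = ⊥-elim (q (trans (sym (m+n∸n≡m c j)) (cong (_∸ j) p)))
  ... | no p | yes q = ⊥-elim (p (trans (cong (_+ j) q) (m∸n+n≡m jk)))

  ≟-+-≰ : ∀ c j k → ¬ j ≤ k → ⌊ c + j ℕ.≟ k ⌋ ≡ false
  ≟-+-≰ c j k jk with c + j ℕ.≟ k
  ... | yes p = ⊥-elim (jk (subst (j ≤_) p (m≤n+m j c)))
  ... | no p = refl

  module ArcsAt {M : ℕ} (v : Fin M) where
    B-at : ∀ dir K ov x y → arcsOf (zip (map (edgeAt dir v) K) ov) x y ≡ true →
      ((x ≡ v) × ((y , dir) ∈ zip K ov)) ⊎ ((y ≡ v) × ((x , not dir) ∈ zip K ov))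
    B-at dir (k ∷ K) (c ∷ ov) x y h with ∨-true {arcOf (edgeAt dir v k , c) x y} h
    ... | inj₂ r with B-at dir K ov x y r
    ...   | inj₁ (a , b) = inj₁ (a , there b)
    ...   | inj₂ (a , b) = inj₂ (a , there b)
    B-at false (k ∷ K) (false ∷ ov) x y h | inj₁ s with ∧-true {v ==ᶠ x} {k ==ᶠ y} s
    ... | e1 , e2 with ==-sound e1 | ==-sound e2
    ... | refl | refl = inj₁ (refl , here refl)
    B-at false (k ∷ K) (true ∷ ov) x y h | inj₁ s with ∧-true {k ==ᶠ x} {v ==ᶠ y} s
    ... | e1 , e2 with ==-sound e1 | ==-sound e2
    ... | refl | refl = inj₂ (refl , here refl)
    B-at true (k ∷ K) (false ∷ ov) x y h | inj₁ s with ∧-true {k ==ᶠ x} {v ==ᶠ y} s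
    ... | e1 , e2 with ==-sound e1 | ==-sound e2
    ... | refl | refl = inj₂ (refl , here refl)
    B-at true (k ∷ K) (true ∷ ov) x y h | inj₁ s with ∧-true {v ==ᶠ x} {k ==ᶠ y} s
    ... | e1 , e2 with ==-sound e1 | ==-sound e2
    ... | refl | refl = inj₁ (refl , here refl)

    B-out : ∀ dir K ov y → (y , dir) ∈ zip K ov → arcsOf (zip (map (edgeAt dir v) K) ov) v y ≡ true
    B-out false K ov y m = true-any _ (zip-map-mem (edgeAt false v) m) (true-∧ (==-refl v) (==-refl y))
    B-out true K ov y m = true-any _ (zip-map-mem (edgeAt true v) m) (true-∧ (==-refl v) (==-refl y))

    B-in : ∀ dir K ov x → (x , not dir) ∈ zip K ov → arcsOf (zip (map (edgeAt dir v) K) ov) x v ≡ true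
    B-in false K ov x m = true-any _ (zip-map-mem (edgeAt false v) m) (true-∧ (==-refl x) (==-refl v))
    B-in true K ov x m = true-any _ (zip-map-mem (edgeAt true v) m) (true-∧ (==-refl x) (==-refl v))

  InsBeforeOuts→IsSegment : ∀ {M} dir (A : Fin M → Fin M → Bool) K ov →
    (∀ b a → (b , not dir) ∈ zip K ov → (a , dir) ∈ zip K ov → A b a ≡ true) → IsSegment (orderAt dir A) K ov
  InsBeforeOuts→IsSegment false A K ov dc = λ x y mx my → dc x y mx my
  InsBeforeOuts→IsSegment true A K ov dc = λ x y mx my → dc y x my mx

  IsSegment→InsBeforeOuts : ∀ {M} dir (A : Fin M → Fin M → Bool) K ov → IsSegment (orderAt dir A) K ov →
    (∀ b a → (b , not dir) ∈ zip K ov → (a , dir) ∈ zip K ov → A b a ≡ true)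
  IsSegment→InsBeforeOuts false A K ov d = λ b a ib oa → d b a ib oa
  IsSegment→InsBeforeOuts true A K ov d = λ b a ib oa → d a b oa ib

  module Reversible {M : ℕ} (A : Fin M → Fin M → Bool) (K : List (Fin M))
    (asymA : ∀ {x y} → A x y ≡ true → A y x ≡ true → ⊥)
    (totA : ∀ {x y} → x ∈ K → y ∈ K → x ≢ y → (A x y ≡ true) ⊎ (A y x ≡ true))
    (trA : ∀ {x y z} → x ∈ K → y ∈ K → z ∈ K → A x y ≡ true → A y z ≡ true → A x z ≡ true) where
    asymT : ∀ dir {x y} → x ∈ K → y ∈ K → orderAt dir A x y ≡ true → orderAt dir A y x ≡ true → ⊥
    asymT false _ _ = asymA
    asymT true _ _ = asymA

    totT : ∀ dir {x y} → x ∈ K → y ∈ K → x ≢ y → (orderAt dir A x y ≡ true) ⊎ (orderAt dir A y x ≡ true)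
    totT false xK yK xy = totA xK yK xy
    totT true xK yK xy with totA xK yK xy
    ... | inj₁ h = inj₂ h
    ... | inj₂ h = inj₁ h

    trT : ∀ dir {x y z} → x ∈ K → y ∈ K → z ∈ K → orderAt dir A x y ≡ true → orderAt dir A y z ≡ true → orderAt dir A x z ≡ true
    trT false xK yK zK = trA xK yK zK
    trT true xK yK zK = λ h1 h2 → trA zK yK xK h2 h1

  module ApexSums {M : ℕ} (v : Fin M) (dir : Bool) (K : List (Fin M)) (uK : Unique K)
    (K≢v : ∀ {k} → k ∈ K → k ≢ v) (Z : LabelledEdges M)
    (Z-avoids : ∀ x y → arcsOf Z x y ≡ true → (x ≢ v) × (y ≢ v))
    (clique : ∀ {x y} → x ∈ K → y ∈ K → x ≢ y → (arcsOf Z x y ≡ true) ⊎ (arcsOf Z y x ≡ true)) where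

    A : Fin M → Fin M → Bool
    A = arcsOf Z

    m : ℕ
    m = length K

    Ev : List (Fin M × Fin M)
    Ev = map (edgeAt dir v) K

    T : Fin M → Fin M → Bool
    T = orderAt dir A

    module Labelling (ov : List Bool) where
      In : Fin M → Set
      In x = (x , not dir) ∈ zip K ov
      Out : Fin M → Set
      Out x = (x , dir) ∈ zip K ov
      open Apex v A (arcsOf (zip Ev ov)) In Out Z-avoids
        (ArcsAt.B-at v dir K ov) (ArcsAt.B-out v dir K ov) (ArcsAt.B-in v dir K ov)
        (λ x i → K≢v (zip-fst i)) (λ x o → K≢v (zip-fst o)) public

      clique′ : ∀ x y → (In x ⊎ Out x) → (In y ⊎ Out y) → x ≢ y → (A x y ≡ true) ⊎ (A y x ≡ true)
      clique′ x y ix iy xy = clique (mem ix) (mem iy) xy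
        where
        mem : ∀ {z} → (In z ⊎ Out z) → z ∈ K
        mem (inj₁ i) = zip-fst i
        mem (inj₂ o) = zip-fst o

      arcs≡A⁺ : ∀ x y → arcsOf (zip Ev ov ++ Z) x y ≡ A⁺ x y
      arcs≡A⁺ x y = any-++ _ (zip Ev ov) Z

      acyclic≡segment : hasCycleR A ≡ false → not (hasCycleR (arcsOf (zip Ev ov ++ Z))) ≡ isSegment T K ov
      acyclic≡segment hA rewrite hasCycleR-cong _ _ arcs≡A⁺ with isSegment T K ov in e
      ... | true rewrite split⇒acyclic hA (IsSegment→InsBeforeOuts dir A K ov (isSegment-sound T K ov e)) = refl
      ... | false with hasCycleR A⁺ in f
      ...   | true = refl
      ...   | false with trans (sym (isSegment-complete T K ov
                        (InsBeforeOuts→IsSegment dir A K ov (proj₂ (acyclic⇒split clique′ f))))) e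
      ...     | ()

      cyclic⇒cyclic : hasCycleR A ≡ true → hasCycleR (arcsOf (zip Ev ov ++ Z)) ≡ true
      cyclic⇒cyclic hA = trans (hasCycleR-cong _ _ arcs≡A⁺) (Cyc→hasCyc A⁺ (cycle-withApex (hasCyc→Cyc A hA)))

    module AcyclicZ (hA : hasCycleR A ≡ false) where
      ¬cyc : Cyc A → ⊥
      ¬cyc c with trans (sym (Cyc→hasCyc A c)) hA
      ... | ()

      asymA : ∀ {x y} → A x y ≡ true → A y x ≡ true → ⊥
      asymA {x} h1 h2 = ¬cyc (1 , x , cons h1 (cons h2 nil))

      trA : ∀ {x y z} → x ∈ K → y ∈ K → z ∈ K → A x y ≡ true → A y z ≡ true → A x z ≡ true
      trA {x} {y} {z} xK yK zK h1 h2 with x ≟ z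
      ... | yes refl = ⊥-elim (asymA h1 h2)
      ... | no xz with clique xK zK xz
      ...   | inj₁ h = h
      ...   | inj₂ h = ⊥-elim (¬cyc (2 , x , cons h1 (cons h2 (cons h nil))))

      open Reversible A K asymA clique trA
      open StrictTotal T K (asymT dir) (totT dir) (trT dir) using (segmentCount)

      segmentCount-shifted : ∀ k j → sumBools m (λ ov → 𝟙 (isSegment T K ov ∧ ⌊ countTrue ov + j ℕ.≟ k ⌋)) ≡ windowInd k m j
      segmentCount-shifted k j with j ≤? k
      ... | yes jk = trans (sumBools-cong m (λ ov _ → cong (λ z → 𝟙 (isSegment T K ov ∧ z)) (≟-+ (countTrue ov) j k jk)))
                       (segmentCount K (λ x → x) uK (k ∸ j))
      ... | no jk = trans (sumBools-cong m (λ ov _ → trans (cong (λ z → 𝟙 (isSegment T K ov ∧ z)) (≟-+-≰ (countTrue ov) j k jk))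
                                            (cong 𝟙 (∧-zeroʳ (isSegment T K ov))))) (sumBools-0 m)

    apexSum : ∀ k → sumBools m (λ ov → acyclicWithDes k (zip Ev ov ++ Z)) ≡ 𝟙 (not (hasCycleR A)) * windowInd k m (desOf Z)
    apexSum k with hasCycleR A in hA
    ... | true = trans (sumBools-cong m (λ ov _ →
                   cong (λ z → 𝟙 (not z ∧ ⌊ desOf (zip Ev ov ++ Z) ℕ.≟ k ⌋)) (Labelling.cyclic⇒cyclic ov hA)))
                 (sumBools-0 m)
    ... | false = trans (sumBools-cong m (λ ov e → cong₂ (λ a b → 𝟙 (a ∧ b))
                            (Labelling.acyclic≡segment ov hA)
                            (cong (λ z → ⌊ z ℕ.≟ k ⌋) (trans (desOf-++ (zip Ev ov) Z)
                                (cong (_+ desOf Z) (sym (countTrue≡desOf Ev ov (trans e (sym (length-map (edgeAt dir v) K))))))))))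
                   (trans (AcyclicZ.segmentCount-shifted hA k (desOf Z)) (sym (+-identityʳ _)))

module Relabel where

  -- Deleting a vertex v renames the remaining vertices by punchOut, i.e.
  -- the edges of G − v are the images under punchIn v of the edges of a
  -- graph on Fin N.

  open import Defs using (_==ᶠ_)
  open Orientations
  open Walks
  open BoolFacts using (𝟙; ∧-true; ==-sound; any-cong; any-true)
  open import Data.Nat using (ℕ; suc; _+_)
  open import Data.Bool using (Bool; true; false; _∧_; _∨_)
  import Data.Bool.ListAction
  open import Data.Fin using (Fin; _≟_; punchIn; punchOut)
  open import Data.Fin.Properties using (punchIn-injective; punchInᵢ≢i; punchIn-punchOut; punchOut-cong)
  open import Data.List using (List; []; _∷_; map; zip)
  open import Data.List.Membership.Propositional.Properties using (∈-map⁻)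
  open import Data.Product using (_×_; _,_; proj₁; proj₂)
  open import Relation.Nullary using (yes; no)
  open import Relation.Binary.PropositionalEquality
  open import Data.Empty using (⊥-elim)
  open import Function using (case_of_)

  module Punch {N : ℕ} (v : Fin (suc N)) where
    lift : Fin N → Fin (suc N)
    lift = punchIn v

    liftPair : Fin N × Fin N → Fin (suc N) × Fin (suc N)
    liftPair (i , j) = (lift i , lift j)

    liftLabelled : (Fin N × Fin N) × Bool → (Fin (suc N) × Fin (suc N)) × Bool
    liftLabelled (e , c) = (liftPair e , c)

    zip-lift : ∀ E o → zip (map liftPair E) o ≡ map liftLabelled (zip E o)
    zip-lift [] o = refl
    zip-lift (e ∷ E) [] = refl
    zip-lift (e ∷ E) (c ∷ o) = cong (_ ∷_) (zip-lift E o)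

    ==-lift : ∀ i x → (lift i ==ᶠ lift x) ≡ (i ==ᶠ x)
    ==-lift i x with i ≟ x | lift i ≟ lift x
    ... | yes p | yes q = refl
    ... | no p | no q = refl
    ... | yes p | no q = ⊥-elim (q (cong lift p))
    ... | no p | yes q = ⊥-elim (p (punchIn-injective v i x q))

    arcOf-lift : ∀ e x y → arcOf (liftLabelled e) (lift x) (lift y) ≡ arcOf e x y
    arcOf-lift ((i , j) , false) x y = cong₂ _∧_ (==-lift i x) (==-lift j y)
    arcOf-lift ((i , j) , true) x y = cong₂ _∧_ (==-lift j x) (==-lift i y)

    any-map : ∀ {A B : Set} (p : B → Bool) (f : A → B) xs → Data.Bool.ListAction.any p (map f xs) ≡ Data.Bool.ListAction.any (λ x → p (f x)) xs
    any-map p f [] = refl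
    any-map p f (x ∷ xs) = cong (p (f x) ∨_) (any-map p f xs)

    arcsOf-lift : ∀ E o x y → arcsOf (zip (map liftPair E) o) (lift x) (lift y) ≡ arcsOf (zip E o) x y
    arcsOf-lift E o x y rewrite zip-lift E o = trans (any-map _ liftLabelled (zip E o)) (any-cong _ _ (λ e → arcOf-lift e x y) (zip E o))

    arcOf-lift-avoids : ∀ e x y → arcOf (liftLabelled e) x y ≡ true → (x ≢ v) × (y ≢ v)
    arcOf-lift-avoids ((i , j) , false) x y h with ∧-true {lift i ==ᶠ x} {lift j ==ᶠ y} h
    ... | e1 , e2 with ==-sound e1 | ==-sound e2
    ... | refl | refl = punchInᵢ≢i v i , punchInᵢ≢i v j
    arcOf-lift-avoids ((i , j) , true) x y h with ∧-true {lift j ==ᶠ x} {lift i ==ᶠ y} h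
    ... | e1 , e2 with ==-sound e1 | ==-sound e2
    ... | refl | refl = punchInᵢ≢i v j , punchInᵢ≢i v i

    arcsOf-lift-avoids : ∀ E o x y → arcsOf (zip (map liftPair E) o) x y ≡ true → (x ≢ v) × (y ≢ v)
    arcsOf-lift-avoids E o x y h rewrite zip-lift E o with any-true _ (map liftLabelled (zip E o)) h
    ... | e , m , s with ∈-map⁻ liftLabelled m
    ...   | e' , _ , refl = arcOf-lift-avoids e' x y s

    module _ (E : List (Fin N × Fin N)) (o : List Bool) where
      A2 : Fin (suc N) → Fin (suc N) → Bool
      A2 = arcsOf (zip (map liftPair E) o)

      A1 : Fin N → Fin N → Bool
      A1 = arcsOf (zip E o)

      lower : (x : Fin (suc N)) → x ≢ v → Fin N
      lower x h = punchOut {i = v} {j = x} (λ e → h (sym e))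

      lift-lower : ∀ x h → lift (lower x h) ≡ x
      lift-lower x h = punchIn-punchOut _

      walk-lower : ∀ {ℓ a b} → (ha : a ≢ v) (hb : b ≢ v) → Walk A2 ℓ a b → Walk A1 ℓ (lower a ha) (lower b hb)
      walk-lower ha hb nil = subst (λ z → Walk A1 0 (lower _ ha) z) (punchOut-cong v refl) nil
      walk-lower {a = a} ha hb (cons {c = c} h W) = cons h' (walk-lower hc hb W)
        where
        hc : c ≢ v
        hc = proj₂ (arcsOf-lift-avoids E o a c h)
        h' : A1 (lower a ha) (lower c hc) ≡ true
        h' = trans (sym (arcsOf-lift E o (lower a ha) (lower c hc))) (subst₂ (λ p q → A2 p q ≡ true) (sym (lift-lower a ha)) (sym (lift-lower c hc)) h)

      cycle-lower : Cyc A2 → Cyc A1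
      cycle-lower (ℓ , a , cons {c = c} h W) = ℓ , lower a ha , walk-lower ha ha (cons h W)
        where
        ha : a ≢ v
        ha = proj₁ (arcsOf-lift-avoids E o a c h)

      cycle-lift : Cyc A1 → Cyc A2
      cycle-lift = mapCyc A1 A2 lift (λ a b h → trans (arcsOf-lift E o a b) h)

      hasCycle-lift : hasCycleR A2 ≡ hasCycleR A1
      hasCycle-lift with hasCycleR A2 in e2 | hasCycleR A1 in e1
      ... | true | true = refl
      ... | false | false = refl
      ... | true | false = ⊥-elim (case trans (sym (Cyc→hasCyc A1 (cycle-lower (hasCyc→Cyc A2 e2)))) e1 of λ ())
      ... | false | true = ⊥-elim (case trans (sym (Cyc→hasCyc A2 (cycle-lift (hasCyc→Cyc A1 e1)))) e2 of λ ())

    desOf-lift : ∀ E o → desOf (zip (map liftPair E) o) ≡ desOf (zip E o)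
    desOf-lift [] o = refl
    desOf-lift (e ∷ E) [] = refl
    desOf-lift (e ∷ E) (c ∷ o) = cong (𝟙 c +_) (desOf-lift E o)

module VertexDeletion where

  -- Proof: split the
  -- orientations of G into an orientation of G − v and a labelling of the
  -- edges at v (Orientations), sum over the latter first (ApexSum), and
  -- recognise the resulting sum as a coefficient of the product.

  open import Defs
  open BoolFacts
  open BoolListSums
  open Orientations
  open ApexSum
  open Relabel
  open import Data.Nat as ℕ using (ℕ; suc; _+_; _*_; _∸_; _≤_; s≤s; _≤?_)
  open import Data.Nat.Properties using (_<?_; suc-injective; *-zeroʳ; *-identityʳ; +-identityʳ; m∸n≤m; m∸[m∸n]≡n)
  open import Data.Bool using (Bool; true; false; _∧_; _∨_; not)
  import Data.Bool
  open import Data.Fin using (Fin)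
  open import Data.List using (List; []; _∷_; map; length; zip; _++_; filter; upTo)
  open import Data.List.Properties using (length-map)
  open import Data.Nat.ListAction using (sum)
  open import Data.List.Membership.Propositional using (_∈_)
  open import Data.List.Membership.Propositional.Properties using (∈-upTo⁺; ∈-upTo⁻)
  open import Data.List.Relation.Unary.Any using (here; there)
  import Data.List.Relation.Unary.All as All
  open import Data.List.Relation.Unary.AllPairs using (_∷_)
  open import Data.List.Relation.Unary.Unique.Propositional using (Unique)
  open import Data.List.Relation.Unary.Unique.Propositional.Properties using (upTo⁺)
  open import Data.Product using (_×_; _,_; Σ)
  open import Data.Sum using (_⊎_; inj₁; inj₂)
  open import Relation.Nullary using (yes; no; ⌊_⌋)
  open import Relation.Binary.PropositionalEquality
  open import Data.Empty using (⊥-elim)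
  open ≡-Reasoning

  sum-zero : ∀ {A : Set} (h : A → ℕ) xs → (∀ i → i ∈ xs → h i ≡ 0) → sum (map h xs) ≡ 0
  sum-zero h [] z = refl
  sum-zero h (x ∷ xs) z rewrite z x (here refl) = sum-zero h xs (λ i m → z i (there m))

  sum-delta : ∀ {A : Set} (h : A → ℕ) xs i0 → Unique xs → i0 ∈ xs → (∀ i → i ∈ xs → i ≢ i0 → h i ≡ 0) →
    sum (map h xs) ≡ h i0
  sum-delta h (x ∷ xs) i0 (ax ∷ u) (here refl) z =
    trans (cong (h x +_) (sum-zero h xs (λ i m → z i (there m) (λ e → All.lookup ax m (sym e))))) (+-identityʳ _)
  sum-delta h (x ∷ xs) i0 (ax ∷ u) (there mi) z =
    trans (cong (_+ sum (map h xs)) (z x (here refl) (λ e → All.lookup ax mi e))) (sum-delta h xs i0 u mi (λ i m → z i (there m)))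

  qint-suc : ∀ m i → qint (suc m) i ≡ 𝟙 ⌊ i ≤? m ⌋
  qint-suc m i with i <? suc m | i ≤? m
  ... | yes p | yes q = refl
  ... | no p | no q = refl
  ... | yes p | no q = ⊥-elim (q (ℕ.s≤s⁻¹ p))
  ... | no p | yes q = ⊥-elim (p (s≤s q))

  convolution-window : ∀ k m d a →
    sum (map (λ i → qint (suc m) i * 𝟙 (a ∧ ⌊ d ℕ.≟ k ∸ i ⌋)) (upTo (suc k))) ≡ 𝟙 a * windowInd k m d
  convolution-window k m d false = sum-zero _ (upTo (suc k)) (λ i _ → *-zeroʳ (qint (suc m) i))
  convolution-window k m d true with d ≤? k
  ... | yes dk = trans (sum-delta _ (upTo (suc k)) (k ∸ d) (upTo⁺ (suc k)) (∈-upTo⁺ (s≤s (m∸n≤m k d))) others-vanish)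
                   (trans (cong₂ _*_ (qint-suc m (k ∸ d)) d-matches) (trans (*-identityʳ _) (sym (+-identityʳ _))))
    where
    d-matches : 𝟙 ⌊ d ℕ.≟ k ∸ (k ∸ d) ⌋ ≡ 1
    d-matches with d ℕ.≟ k ∸ (k ∸ d)
    ... | yes _ = refl
    ... | no p = ⊥-elim (p (sym (m∸[m∸n]≡n dk)))
    others-vanish : ∀ i → i ∈ upTo (suc k) → i ≢ k ∸ d → qint (suc m) i * 𝟙 ⌊ d ℕ.≟ k ∸ i ⌋ ≡ 0
    others-vanish i mi ne with d ℕ.≟ k ∸ i
    ... | no _ = *-zeroʳ (qint (suc m) i)
    ... | yes p = ⊥-elim (ne (trans (sym (m∸[m∸n]≡n (ℕ.s≤s⁻¹ (∈-upTo⁻ mi)))) (cong (k ∸_) (sym p))))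
  ... | no dk = sum-zero _ (upTo (suc k)) none
    where
    none : ∀ i → i ∈ upTo (suc k) → qint (suc m) i * 𝟙 ⌊ d ℕ.≟ k ∸ i ⌋ ≡ 0
    none i mi with d ℕ.≟ k ∸ i
    ... | no _ = *-zeroʳ (qint (suc m) i)
    ... | yes p = ⊥-elim (dk (subst (_≤ k) (sym p) (m∸n≤m k i)))

  touches : ∀ {M} → Fin M → Fin M × Fin M → Bool
  touches v (i , j) = (i ==ᶠ v) ∨ (j ==ᶠ v)

  zip-mem : ∀ {X : Set} {E : List X} {o : List Bool} {e} → e ∈ E → length o ≡ length E → Σ Bool λ c → (e , c) ∈ zip E o
  zip-mem {E = x ∷ E} {c ∷ o} (here refl) _ = c , here refl
  zip-mem {E = x ∷ E} {c ∷ o} (there m) h with zip-mem {E = E} {o} m (suc-injective h)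
  ... | c' , m' = c' , there m'

  module DeleteVertex {N : ℕ} (G : Graph (suc N)) (G' : Graph N) (v : Fin (suc N)) (dir : Bool) (K : List (Fin (suc N)))
    (uK : Unique K) (K≢v : ∀ {k} → k ∈ K → k ≢ v)
    -- G − v, renumbered, is G'
    (edgesAvoiding : filter (λ e → Data.Bool._≟_ (not (touches v e)) true) (edges G) ≡ map (Punch.liftPair v) (edges G'))
    (edgesAt : filter (λ e → Data.Bool._≟_ (touches v e) true) (edges G) ≡ map (edgeAt dir v) K)
    (K-clique : ∀ {x y} → x ∈ K → y ∈ K → x ≢ y →
                 ((x , y) ∈ map (Punch.liftPair v) (edges G')) ⊎ ((y , x) ∈ map (Punch.liftPair v) (edges G')))
    where
    open Punch v

    E' : List (Fin N × Fin N)
    E' = edges G'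

    E Ẽ : List (Fin (suc N) × Fin (suc N))
    E = edges G
    Ẽ = map liftPair E'

    Ev : List (Fin (suc N) × Fin (suc N))
    Ev = map (edgeAt dir v) K

    m r : ℕ
    m = length K
    r = length E'

    R-split : ∀ k → R G k ≡ sumBools m (λ ov → sumBools r (λ o → acyclicWithDes k (zip Ev ov ++ zip Ẽ o)))
    R-split k = begin
      R G k
        ≡⟨ R≡sumBools G k ⟩
      sumBools (length E) (λ o → acyclicWithDes k (zip E o))
        ≡⟨ sumBools-shuffle (shuffle-filter (touches v) E) (acyclicWithDes k) (acyclicWithDes-move k) ⟩
      _ ≡⟨ cong₂ (λ P Q → sumBools (length P) (λ ov → sumBools (length Q) (λ oq → acyclicWithDes k (zip P ov ++ zip Q oq))))
                 edgesAt edgesAvoiding ⟩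
      sumBools (length Ev) (λ ov → sumBools (length Ẽ) (λ o → acyclicWithDes k (zip Ev ov ++ zip Ẽ o)))
        ≡⟨ cong₂ (λ a b → sumBools a (λ ov → sumBools b (λ o → acyclicWithDes k (zip Ev ov ++ zip Ẽ o))))
                 (length-map (edgeAt dir v) K) (length-map liftPair E') ⟩
      sumBools m (λ ov → sumBools r (λ o → acyclicWithDes k (zip Ev ov ++ zip Ẽ o))) ∎

    oriented-clique : ∀ o → length o ≡ r → ∀ {x y} → x ∈ K → y ∈ K → x ≢ y →
      (arcsOf (zip Ẽ o) x y ≡ true) ⊎ (arcsOf (zip Ẽ o) y x ≡ true)
    oriented-clique o lo {x} {y} xK yK xy with K-clique xK yK xy
    ... | inj₁ m1 with zip-mem {E = Ẽ} {o} m1 (trans lo (sym (length-map liftPair E')))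
    ...   | false , mz = inj₁ (true-any _ mz (true-∧ (==-refl x) (==-refl y)))
    ...   | true , mz = inj₂ (true-any _ mz (true-∧ (==-refl y) (==-refl x)))
    oriented-clique o lo {x} {y} xK yK xy | inj₂ m1 with zip-mem {E = Ẽ} {o} m1 (trans lo (sym (length-map liftPair E')))
    ...   | false , mz = inj₂ (true-any _ mz (true-∧ (==-refl y) (==-refl x)))
    ...   | true , mz = inj₁ (true-any _ mz (true-∧ (==-refl x) (==-refl y)))

    R-deleteVertex : R G ≈ₚ (qint (suc m) ⊛ R G')
    R-deleteVertex k = begin
      R G k
        ≡⟨ R-split k ⟩
      sumBools m (λ ov → sumBools r (λ o → acyclicWithDes k (zip Ev ov ++ zip Ẽ o)))
        ≡⟨ sumBools-comm m r _ ⟩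
      sumBools r (λ o → sumBools m (λ ov → acyclicWithDes k (zip Ev ov ++ zip Ẽ o)))
        ≡⟨ sumBools-cong r (λ o lo → ApexSums.apexSum v dir K uK K≢v (zip Ẽ o)
                                        (arcsOf-lift-avoids E' o) (oriented-clique o lo) k) ⟩
      sumBools r (λ o → 𝟙 (not (hasCycleR (arcsOf (zip Ẽ o)))) * windowInd k m (desOf (zip Ẽ o)))
        ≡⟨ sumBools-cong r (λ o _ → cong₂ (λ a b → 𝟙 (not a) * windowInd k m b) (hasCycle-lift E' o) (desOf-lift E' o)) ⟩
      sumBools r (λ o → 𝟙 (not (hasCycleR (arcsOf (zip E' o)))) * windowInd k m (desOf (zip E' o)))
        ≡⟨ sumBools-cong r (λ o _ → sym (convolution-window k m (desOf (zip E' o)) (not (hasCycleR (arcsOf (zip E' o)))))) ⟩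
      sumBools r (λ o → sum (map (λ i → qint (suc m) i * acyclicWithDes (k ∸ i) (zip E' o)) (upTo (suc k))))
        ≡⟨ sumBools-sum r (upTo (suc k)) (λ i o → qint (suc m) i * acyclicWithDes (k ∸ i) (zip E' o)) ⟩
      sum (map (λ i → sumBools r (λ o → qint (suc m) i * acyclicWithDes (k ∸ i) (zip E' o))) (upTo (suc k)))
        ≡⟨ sum-map-cong (λ i → trans (sumBools-* r (qint (suc m) i) _)
                                     (cong (qint (suc m) i *_) (sym (R≡sumBools G' (k ∸ i))))) (upTo (suc k)) ⟩
      (qint (suc m) ⊛ R G') k ∎

module FilterLemmas where

  open import Data.Bool using (Bool; true; false; _∧_; if_then_else_)
  import Data.Bool as B
  open import Data.List using (List; []; _∷_; map; filter; _++_; concatMap)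
  open import Data.List.Properties using (filter-++; ++-identityʳ)
  open import Data.List.Membership.Propositional using (_∈_)
  open import Data.List.Relation.Unary.Any using (here; there)
  import Data.List.Relation.Unary.All as All
  open import Data.List.Relation.Unary.AllPairs using (_∷_)
  open import Data.List.Relation.Unary.Unique.Propositional using (Unique)
  open import Relation.Binary.PropositionalEquality
  open import Function using (_∘_)

  filt : ∀ {A : Set} → (A → Bool) → List A → List A
  filt b = filter (λ x → B._≟_ (b x) true)

  module _ {A : Set} where
    filt-cong : ∀ {b c : A → Bool} → (∀ x → b x ≡ c x) → ∀ xs → filt b xs ≡ filt c xs
    filt-cong {b} {c} h [] = refl
    filt-cong {b} {c} h (x ∷ xs) with b x | c x | h x
    ... | true | true | refl = cong (x ∷_) (filt-cong h xs)
    ... | false | false | refl = filt-cong h xs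

    filt-filt : ∀ (b c : A → Bool) xs → filt b (filt c xs) ≡ filt (λ x → c x ∧ b x) xs
    filt-filt b c [] = refl
    filt-filt b c (x ∷ xs) with c x
    ... | false = filt-filt b c xs
    ... | true with b x
    ...   | true = cong (x ∷_) (filt-filt b c xs)
    ...   | false = filt-filt b c xs

    filt-none : ∀ (b : A → Bool) xs → (∀ x → x ∈ xs → b x ≡ false) → filt b xs ≡ []
    filt-none b [] h = refl
    filt-none b (x ∷ xs) h with b x | h x (here refl)
    ... | false | refl = filt-none b xs (λ y m → h y (there m))

    filt-all : ∀ (b : A → Bool) xs → (∀ x → x ∈ xs → b x ≡ true) → filt b xs ≡ xs
    filt-all b [] h = refl
    filt-all b (x ∷ xs) h with b x | h x (here refl)
    ... | true | refl = cong (x ∷_) (filt-all b xs (λ y m → h y (there m)))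

    concatMap-cong : ∀ {C : Set} (f g : A → List C) xs → (∀ x → x ∈ xs → f x ≡ g x) → concatMap f xs ≡ concatMap g xs
    concatMap-cong f g [] h = refl
    concatMap-cong f g (x ∷ xs) h = cong₂ _++_ (h x (here refl)) (concatMap-cong f g xs (λ y m → h y (there m)))

    concatMap-single : ∀ {C : Set} (f : A → List C) xs d → Unique xs → d ∈ xs →
      (∀ x → x ∈ xs → x ≢ d → f x ≡ []) → concatMap f xs ≡ f d
    concatMap-single f (x ∷ xs) d (ax ∷ u) (here refl) h =
      trans (cong (f x ++_) (none xs (λ y m → h y (there m) (λ e → All.lookup ax m (sym e))))) (++-identityʳ (f x))
      where
      none : ∀ ys → (∀ y → y ∈ ys → f y ≡ []) → concatMap f ys ≡ []
      none [] _ = refl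
      none (y ∷ ys) g rewrite g y (here refl) = none ys (λ z m → g z (there m))
    concatMap-single f (x ∷ xs) d (ax ∷ u) (there m) h =
      trans (cong (_++ concatMap f xs) (h x (here refl) (λ e → All.lookup ax m e)))
            (concatMap-single f xs d u m (λ y m' → h y (there m')))

  filt-map : ∀ {A C : Set} (b : C → Bool) (f : A → C) xs → filt b (map f xs) ≡ map f (filt (b ∘ f) xs)
  filt-map b f [] = refl
  filt-map b f (x ∷ xs) with b (f x)
  ... | true = cong (f x ∷_) (filt-map b f xs)
  ... | false = filt-map b f xs

  filt-concatMap : ∀ {A C : Set} (b : C → Bool) (f : A → List C) xs → filt b (concatMap f xs) ≡ concatMap (filt b ∘ f) xs
  filt-concatMap b f [] = refl
  filt-concatMap b f (x ∷ xs) =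
    trans (filter-++ (λ y → B._≟_ (b y) true) (f x) (concatMap f xs)) (cong (filt b (f x) ++_) (filt-concatMap b f xs))

  concatMap-if : ∀ {A C : Set} (c : A → Bool) (g : A → C) xs →
    concatMap (λ x → if c x then g x ∷ [] else []) xs ≡ map g (filt c xs)
  concatMap-if c g [] = refl
  concatMap-if c g (x ∷ xs) with c x
  ... | true = cong (g x ∷_) (concatMap-if c g xs)
  ... | false = concatMap-if c g xs

  concatMap-filt : ∀ {A C : Set} (c : A → Bool) (g : A → List C) (f : A → List C) xs →
    (∀ x → x ∈ xs → f x ≡ (if c x then g x else [])) → concatMap f xs ≡ concatMap g (filt c xs)
  concatMap-filt c g f [] h = refl
  concatMap-filt c g f (x ∷ xs) h with c x | h x (here refl)
  ... | true | e = cong₂ _++_ e (concatMap-filt c g f xs (λ y m → h y (there m)))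
  ... | false | e = trans (cong (_++ concatMap f xs) e) (concatMap-filt c g f xs (λ y m → h y (there m)))

module InversionGraph where

  -- The inversion graph of flat(w,v) is the inversion graph of w with the
  -- vertex v deleted: an edge {i,j} of G_w avoiding v is the punchIn v
  -- image of an edge of G_{flat(w,v)}, since punchIn preserves the order of
  -- positions and (via w) of values.

  open import Defs
  open FilterLemmas
  open VertexDeletion using (touches)
  open Relabel
  open import Data.Nat using (ℕ; suc)
  open import Data.Nat.Properties using (<⇒≤; <-asym)
  open import Data.Bool using (Bool; true; false; _∧_; _∨_; not; if_then_else_)
  open import Data.Bool.Properties using (∧-comm)
  import Data.Fin as F
  open import Data.Fin using (Fin; _≟_; punchIn) renaming (_<?_ to _<ᶠ?_)
  open import Data.Fin.Properties using (punchIn-mono-≤; punchIn-injective; <-cmp; ≤∧≢⇒<; <-irrefl; suc-injective)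
  open import Data.Fin.Permutation using (Permutation′; _⟨$⟩ʳ_; punchIn-permute)
  open import Data.List using (List; []; _∷_; map; concatMap; allFin)
  open import Data.List.Properties using (map-tabulate; map-∘; concatMap-map; map-concatMap)
  open import Data.Product using (_×_; _,_)
  open import Relation.Nullary using (yes; no; ⌊_⌋)
  open import Relation.Binary using (tri<; tri≈; tri>)
  open import Relation.Binary.PropositionalEquality
  open import Data.Empty using (⊥-elim)
  open import Function using (_∘_; id)
  open ≡-Reasoning

  pairs : ∀ M → List (Fin M × Fin M)
  pairs M = concatMap (λ i → map (λ j → (i , j)) (allFin M)) (allFin M)

  isEdge : ∀ {M} → Graph M → Fin M × Fin M → Bool
  isEdge G (i , j) = ⌊ i <ᶠ? j ⌋ ∧ G i j

  allFin-suc : ∀ n → allFin (suc n) ≡ F.zero ∷ map F.suc (allFin n)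
  allFin-suc n = cong (F.zero ∷_) (sym (map-tabulate id F.suc))

  ==-suc : ∀ {n} (a b : Fin n) → (F.suc a ==ᶠ F.suc b) ≡ (a ==ᶠ b)
  ==-suc a b with F.suc a ≟ F.suc b | a ≟ b
  ... | yes p | yes q = refl
  ... | no p | no q = refl
  ... | yes p | no q = ⊥-elim (q (suc-injective p))
  ... | no p | yes q = ⊥-elim (p (cong F.suc q))

  others≡punchIn : ∀ N (v : Fin (suc N)) → filt (λ j → not (j ==ᶠ v)) (allFin (suc N)) ≡ map (punchIn v) (allFin N)
  others≡punchIn N F.zero = begin
    filt (λ j → not (j ==ᶠ F.zero)) (allFin (suc N)) ≡⟨ cong (filt (λ j → not (j ==ᶠ F.zero))) (allFin-suc N) ⟩
    filt (λ j → not (j ==ᶠ F.zero)) (map F.suc (allFin N)) ≡⟨ filt-map (λ j → not (j ==ᶠ F.zero)) F.suc (allFin N) ⟩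
    map F.suc (filt (λ j → not (F.suc j ==ᶠ F.zero)) (allFin N)) ≡⟨ cong (map F.suc) (filt-all (λ j → not (F.suc j ==ᶠ F.zero)) (allFin N) (λ x _ → refl)) ⟩
    map F.suc (allFin N) ∎
  others≡punchIn (suc N) (F.suc v) = begin
    filt (λ j → not (j ==ᶠ F.suc v)) (allFin (suc (suc N))) ≡⟨ cong (filt (λ j → not (j ==ᶠ F.suc v))) (allFin-suc (suc N)) ⟩
    F.zero ∷ filt (λ j → not (j ==ᶠ F.suc v)) (map F.suc (allFin (suc N))) ≡⟨ cong (F.zero ∷_) (filt-map (λ j → not (j ==ᶠ F.suc v)) F.suc (allFin (suc N))) ⟩
    F.zero ∷ map F.suc (filt (λ j → not (F.suc j ==ᶠ F.suc v)) (allFin (suc N))) ≡⟨ cong (λ z → F.zero ∷ map F.suc z) (filt-cong (λ j → cong not (==-suc j v)) (allFin (suc N))) ⟩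
    F.zero ∷ map F.suc (filt (λ j → not (j ==ᶠ v)) (allFin (suc N))) ≡⟨ cong (λ z → F.zero ∷ map F.suc z) (others≡punchIn N v) ⟩
    F.zero ∷ map F.suc (map (punchIn v) (allFin N)) ≡⟨ cong (F.zero ∷_) (sym (map-∘ (allFin N))) ⟩
    F.zero ∷ map (F.suc ∘ punchIn v) (allFin N) ≡⟨ cong (F.zero ∷_) (map-∘ (allFin N)) ⟩
    map (punchIn (F.suc v)) (F.zero ∷ map F.suc (allFin N)) ≡⟨ cong (map (punchIn (F.suc v))) (sym (allFin-suc N)) ⟩
    map (punchIn (F.suc v)) (allFin (suc N)) ∎

  <pI : ∀ {n} (p : Fin (suc n)) (a b : Fin n) → ⌊ punchIn p a <ᶠ? punchIn p b ⌋ ≡ ⌊ a <ᶠ? b ⌋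
  <pI p a b with a <ᶠ? b | punchIn p a <ᶠ? punchIn p b
  ... | yes x | yes y = refl
  ... | no x | no y = refl
  ... | yes x | no y = ⊥-elim (y (≤∧≢⇒< (punchIn-mono-≤ p a b (<⇒≤ x)) (λ e → <-irrefl (punchIn-injective p a b e) x)))
  ... | no x | yes y with <-cmp a b
  ...   | tri< q _ _ = ⊥-elim (x q)
  ...   | tri≈ _ refl _ = ⊥-elim (<-irrefl refl y)
  ...   | tri> _ _ q = ⊥-elim (<-asym y (≤∧≢⇒< (punchIn-mono-≤ p b a (<⇒≤ q)) (λ e → <-irrefl (punchIn-injective p b a e) q)))

  module Deletion {N : ℕ} (w : Permutation′ (suc N)) (v : Fin (suc N)) where
    open Punch v

    G : Graph (suc N)
    G = invGraph w

    G' : Graph N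
    G' = invGraph (flat w v)

    AF : List (Fin (suc N))
    AF = allFin (suc N)

    AFN : List (Fin N)
    AFN = allFin N

    isEdge-lift : ∀ e → isEdge G (liftPair e) ≡ isEdge G' e
    isEdge-lift (i , j) = cong₂ (λ x y → x ∧ (x ∧ y)) (<pI v i j)
      (trans (cong₂ (λ x y → ⌊ x <ᶠ? y ⌋) (punchIn-permute w v j) (punchIn-permute w v i)) (<pI (w ⟨$⟩ʳ v) _ _))

    avoids : Fin (suc N) × Fin (suc N) → Bool
    avoids e = not (touches v e)

    row-avoiding′ : ∀ i b → (i ==ᶠ v) ≡ b → filt avoids (map (λ j → (i , j)) AF) ≡
      (if not b then map (λ j → (i , j)) (map lift AFN) else [])
    row-avoiding′ i true e = trans (filt-map avoids (λ j → (i , j)) AF) (cong (map (λ j → (i , j))) (filt-none _ AF (λ j _ → cong (λ z → not (z ∨ (j ==ᶠ v))) e)))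
    row-avoiding′ i false e = begin
      filt avoids (map (λ j → (i , j)) AF) ≡⟨ filt-map avoids (λ j → (i , j)) AF ⟩
      map (λ j → (i , j)) (filt (λ j → avoids (i , j)) AF) ≡⟨ cong (map (λ j → (i , j))) (filt-cong (λ j → cong (λ z → not (z ∨ (j ==ᶠ v))) e) AF) ⟩
      map (λ j → (i , j)) (filt (λ j → not (j ==ᶠ v)) AF) ≡⟨ cong (map (λ j → (i , j))) (others≡punchIn N v) ⟩
      map (λ j → (i , j)) (map lift AFN) ∎

    row-avoiding : ∀ i → filt avoids (map (λ j → (i , j)) AF) ≡
      (if not (i ==ᶠ v) then map (λ j → (i , j)) (map lift AFN) else [])
    row-avoiding i = row-avoiding′ i (i ==ᶠ v) refl

    pairsAvoiding : filt avoids (pairs (suc N)) ≡ map liftPair (pairs N)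
    pairsAvoiding = begin
      filt avoids (pairs (suc N)) ≡⟨ filt-concatMap avoids (λ i → map (λ j → (i , j)) AF) AF ⟩
      concatMap (λ i → filt avoids (map (λ j → (i , j)) AF)) AF
        ≡⟨ concatMap-filt (λ i → not (i ==ᶠ v)) (λ i → map (λ j → (i , j)) (map lift AFN)) (λ i → filt avoids (map (λ j → (i , j)) AF)) AF (λ i _ → row-avoiding i) ⟩
      concatMap (λ i → map (λ j → (i , j)) (map lift AFN)) (filt (λ i → not (i ==ᶠ v)) AF) ≡⟨ cong (concatMap (λ i → map (λ j → (i , j)) (map lift AFN))) (others≡punchIn N v) ⟩
      concatMap (λ i → map (λ j → (i , j)) (map lift AFN)) (map lift AFN) ≡⟨ concatMap-map (λ i → map (λ j → (i , j)) (map lift AFN)) lift AFN ⟩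
      concatMap (λ i → map (λ j → (lift i , j)) (map lift AFN)) AFN
        ≡⟨ concatMap-cong (λ i → map (λ j → (lift i , j)) (map lift AFN)) (λ i → map liftPair (map (λ j → (i , j)) AFN)) AFN (λ i _ → trans (sym (map-∘ AFN)) (map-∘ AFN)) ⟩
      concatMap (λ i → map liftPair (map (λ j → (i , j)) AFN)) AFN ≡⟨ sym (map-concatMap liftPair (λ i → map (λ j → (i , j)) AFN) AFN) ⟩
      map liftPair (pairs N) ∎

    edgesAvoiding : filt avoids (edges G) ≡ map liftPair (edges G')
    edgesAvoiding = begin
      filt avoids (filt (isEdge G) (pairs (suc N))) ≡⟨ filt-filt avoids (isEdge G) (pairs (suc N)) ⟩
      filt (λ e → isEdge G e ∧ avoids e) (pairs (suc N)) ≡⟨ filt-cong (λ e → ∧-comm (isEdge G e) (avoids e)) (pairs (suc N)) ⟩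
      filt (λ e → avoids e ∧ isEdge G e) (pairs (suc N)) ≡⟨ sym (filt-filt (isEdge G) avoids (pairs (suc N))) ⟩
      filt (isEdge G) (filt avoids (pairs (suc N))) ≡⟨ cong (filt (isEdge G)) pairsAvoiding ⟩
      filt (isEdge G) (map liftPair (pairs N)) ≡⟨ filt-map (isEdge G) liftPair (pairs N) ⟩
      map liftPair (filt (λ e → isEdge G (liftPair e)) (pairs N)) ≡⟨ cong (map liftPair) (filt-cong isEdge-lift (pairs N)) ⟩
      map liftPair (edges G') ∎

module PermutationCounting where

  -- Two counts needed for the exponent m: the number of positions whose
  -- value exceeds e equals the number of values exceeding e (a permutation
  -- only reorders), and the number of elements of Fin (n+1) above e is
  -- n − e.

  open BoolFacts using (𝟙)
  open BoolListSums using (length-filter≡sum)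
  open FilterLemmas
  open InversionGraph using (allFin-suc)
  open import Data.Nat as ℕ using (ℕ; zero; suc; _+_; _∸_)
  open import Data.Nat.Properties using (+-0-commutativeMonoid)
  open import Data.Bool using (Bool)
  import Data.Fin as F
  open import Data.Fin using (Fin; toℕ) renaming (_<?_ to _<ᶠ?_)
  open import Data.Fin.Permutation using (Permutation′; _⟨$⟩ʳ_)
  open import Data.List using (map; length; allFin)
  open import Data.List.Properties using (map-∘; length-map; length-tabulate)
  open import Data.Nat.ListAction renaming (sum to sumL)
  open import Relation.Nullary using (yes; no; ⌊_⌋)
  open import Relation.Binary.PropositionalEquality
  open import Data.Empty using (⊥-elim)
  open import Function using (_∘_)
  open import Algebra.Properties.CommutativeMonoid.Sum +-0-commutativeMonoid using (sum; sum-permute)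
  open ≡-Reasoning

  sum-allFin : ∀ n (f : Fin n → ℕ) → sumL (map f (allFin n)) ≡ sum f
  sum-allFin zero f = refl
  sum-allFin (suc n) f = trans (cong (λ xs → sumL (map f xs)) (allFin-suc n))
    (cong (f F.zero +_) (trans (cong sumL (sym (map-∘ (allFin n)))) (sum-allFin n (f ∘ F.suc))))

  count-permuted : ∀ {N} (π : Permutation′ N) (b : Fin N → Bool) →
    length (filt (λ i → b (π ⟨$⟩ʳ i)) (allFin N)) ≡ length (filt b (allFin N))
  count-permuted {N} π b = begin
    length (filt (λ i → b (π ⟨$⟩ʳ i)) (allFin N)) ≡⟨ length-filter≡sum _ (allFin N) ⟩
    sumL (map (λ i → 𝟙 (b (π ⟨$⟩ʳ i))) (allFin N)) ≡⟨ sum-allFin N _ ⟩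
    sum (λ i → 𝟙 (b (π ⟨$⟩ʳ i)))                 ≡⟨ sum-permute (𝟙 ∘ b) π ⟨
    sum (𝟙 ∘ b)                                   ≡⟨ sum-allFin N _ ⟨
    sumL (map (𝟙 ∘ b) (allFin N))                 ≡⟨ length-filter≡sum b (allFin N) ⟨
    length (filt b (allFin N)) ∎

  <-suc : ∀ {n} (a b : Fin n) → ⌊ F.suc a <ᶠ? F.suc b ⌋ ≡ ⌊ a <ᶠ? b ⌋
  <-suc a b with F.suc a <ᶠ? F.suc b | a <ᶠ? b
  ... | yes p | yes q = refl
  ... | no p | no q = refl
  ... | yes p | no q = ⊥-elim (q (ℕ.s≤s⁻¹ p))
  ... | no p | yes q = ⊥-elim (p (ℕ.s≤s q))

  countAbove : ∀ n (e : Fin (suc n)) → length (filt (λ x → ⌊ e <ᶠ? x ⌋) (allFin (suc n))) ≡ n ∸ toℕ e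
  countAbove n F.zero = begin
    length (filt (λ x → ⌊ F.zero {n} <ᶠ? x ⌋) (allFin (suc n))) ≡⟨ cong (λ xs → length (filt (λ x → ⌊ F.zero {n} <ᶠ? x ⌋) xs)) (allFin-suc n) ⟩
    length (filt (λ x → ⌊ F.zero {n} <ᶠ? x ⌋) (map (F.suc {n}) (allFin n))) ≡⟨ cong length (filt-map (λ x → ⌊ F.zero {n} <ᶠ? x ⌋) (F.suc {n}) (allFin n)) ⟩
    length (map (F.suc {n}) (filt (λ x → ⌊ F.zero {n} <ᶠ? F.suc x ⌋) (allFin n))) ≡⟨ length-map (F.suc {n}) (filt (λ x → ⌊ F.zero {n} <ᶠ? F.suc x ⌋) (allFin n)) ⟩
    length (filt (λ x → ⌊ F.zero {n} <ᶠ? F.suc x ⌋) (allFin n)) ≡⟨ cong length (filt-all _ (allFin n) (λ x _ → refl)) ⟩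
    length (allFin n) ≡⟨ length-tabulate (λ x → x) ⟩
    n ∎
  countAbove (suc n) (F.suc e) = begin
    length (filt (λ x → ⌊ F.suc e <ᶠ? x ⌋) (allFin (suc (suc n)))) ≡⟨ cong (λ xs → length (filt (λ x → ⌊ F.suc e <ᶠ? x ⌋) xs)) (allFin-suc (suc n)) ⟩
    length (filt (λ x → ⌊ F.suc e <ᶠ? x ⌋) (map F.suc (allFin (suc n)))) ≡⟨ cong length (filt-map (λ x → ⌊ F.suc e <ᶠ? x ⌋) F.suc (allFin (suc n))) ⟩
    length (map F.suc (filt (λ x → ⌊ F.suc e <ᶠ? F.suc x ⌋) (allFin (suc n)))) ≡⟨ length-map F.suc (filt (λ x → ⌊ F.suc e <ᶠ? F.suc x ⌋) (allFin (suc n))) ⟩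
    length (filt (λ x → ⌊ F.suc e <ᶠ? F.suc x ⌋) (allFin (suc n))) ≡⟨ cong length (filt-cong (λ x → <-suc e x) (allFin (suc n))) ⟩
    length (filt (λ x → ⌊ e <ᶠ? x ⌋) (allFin (suc n))) ≡⟨ countAbove n e ⟩
    n ∸ toℕ e ∎

module Dichotomy where

  -- If C1 fails, there are d ≤ i < j with w(i) < w(j).  Then i ≠ d, and
  -- w(i) < e (otherwise d, i, j, n would form a 4231).  Every position p < d
  -- has w(p) < e (otherwise p, d, i, n form a 3412); and for e ≤ a < b the
  -- positions of a and b lie after d in decreasing order (otherwise d and
  -- the two positions form a 4231 with n).  That is C2.

  open import Defs
  open import Data.Nat using (ℕ; suc; s≤s)
  import Data.Nat.Properties as ℕ
  import Data.Fin as F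
  open import Data.Fin using (Fin; fromℕ; _<_; _≤_; _<?_; _≤?_)
  open import Data.Fin.Properties
    using (<-cmp; <-trans; <-irrefl; <-asym; ≤-refl; ≤∧≢⇒<; ≤fromℕ; all?; ¬∀⟶∃¬)
  open import Data.Fin.Permutation using (Permutation′; _⟨$⟩ʳ_; _⟨$⟩ˡ_; inverseˡ; inverseʳ)
  open import Data.Vec using (lookup; _∷_; [])
  open import Data.Product using (_,_)
  open import Data.Sum using (_⊎_; inj₁; inj₂)
  open import Data.Empty using (⊥; ⊥-elim)
  open import Relation.Nullary using (¬_; yes; no; Dec)
  open import Relation.Nullary.Decidable using (_→-dec_)
  open import Relation.Binary using (tri<; tri≈; tri>)
  open import Relation.Binary.PropositionalEquality
  open import Function.Bundles using (mk⇔)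

  V4 : ∀ {N} → Fin N → Fin N → Fin N → Fin N → Fin 4 → Fin N
  V4 a b c d = lookup (a ∷ b ∷ c ∷ d ∷ [])

  pattern i0 = F.zero
  pattern i1 = F.suc F.zero
  pattern i2 = F.suc (F.suc F.zero)
  pattern i3 = F.suc (F.suc (F.suc F.zero))

  mono4 : ∀ {N} {a b c d : Fin N} → a < b → b < c → c < d →
          ∀ x y → x < y → V4 a b c d x < V4 a b c d y
  mono4 ab bc cd i0 i1 _ = ab
  mono4 ab bc cd i0 i2 _ = <-trans ab bc
  mono4 ab bc cd i0 i3 _ = <-trans ab (<-trans bc cd)
  mono4 ab bc cd i1 i2 _ = bc
  mono4 ab bc cd i1 i3 _ = <-trans bc cd
  mono4 ab bc cd i2 i3 _ = cd
  mono4 ab bc cd i0 i0 ()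
  mono4 ab bc cd i1 i0 ()
  mono4 ab bc cd i1 i1 (s≤s ())
  mono4 ab bc cd i2 i0 ()
  mono4 ab bc cd i2 i1 (s≤s ())
  mono4 ab bc cd i2 i2 (s≤s (s≤s ()))
  mono4 ab bc cd i3 i0 ()
  mono4 ab bc cd i3 i1 (s≤s ())
  mono4 ab bc cd i3 i2 (s≤s (s≤s ()))
  mono4 ab bc cd i3 i3 (s≤s (s≤s (s≤s ())))

  reflect : ∀ {N} (g : Fin 4 → Fin N) → (∀ x y → x < y → g x < g y) →
            ∀ x y → g x < g y → x < y
  reflect g m x y p with <-cmp x y
  ... | tri< a _ _ = a
  ... | tri≈ _ refl _ = ⊥-elim (<-irrefl refl p)
  ... | tri> _ _ c = ⊥-elim (<-asym p (m y x c))

  contains-pattern : ∀ {N} (w : Permutation′ N) (σ : Fin 4 → Fin 4) {a b c d p q r s : Fin N} →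
        a < b → b < c → c < d → p < q → q < r → r < s →
        (∀ x → w ⟨$⟩ʳ V4 a b c d x ≡ V4 p q r s (σ x)) → Contains w σ
  contains-pattern {N} w σ {a} {b} {c} {d} {p} {q} {r} {s} ab bc cd pq qr rs eq =
    V4 a b c d , mono4 ab bc cd , λ x y → mk⇔
      (λ h → reflect g gm (σ x) (σ y) (subst₂ _<_ (eq x) (eq y) h))
      (λ h → subst₂ _<_ (sym (eq x)) (sym (eq y)) (gm _ _ h))
    where
    g : Fin 4 → Fin N
    g = V4 p q r s
    gm : ∀ x y → x < y → g x < g y
    gm = mono4 pq qr rs

  module Avoiding (n : ℕ) (w : Permutation′ (suc n)) (d e : Fin (suc n))
    (av1 : Avoids w p3412) (av2 : Avoids w p4231)
    (wd : w ⟨$⟩ʳ d ≡ fromℕ n) (wn : w ⟨$⟩ʳ fromℕ n ≡ e) where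

    W : Fin (suc n) → Fin (suc n)
    W i = w ⟨$⟩ʳ i
    Wi : Fin (suc n) → Fin (suc n)
    Wi i = w ⟨$⟩ˡ i
    L : Fin (suc n)
    L = fromℕ n

    C1 C2 : Set
    C1 = ∀ i j → d ≤ i → i < j → (w ⟨$⟩ʳ j) < (w ⟨$⟩ʳ i)
    C2 = ∀ a b → e ≤ a → a < b → (w ⟨$⟩ˡ b) < (w ⟨$⟩ˡ a)

    Winj : ∀ {i j} → W i ≡ W j → i ≡ j
    Winj {i} {j} h = trans (sym (inverseˡ w)) (trans (cong Wi h) (inverseˡ w))

    ≤L : ∀ i → i ≤ L
    ≤L = ≤fromℕ

    ≢⇒<L : ∀ {i} → i ≢ L → i < L
    ≢⇒<L h = ≤∧≢⇒< (≤L _) h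

    W<L : ∀ {i} → i ≢ d → W i < L
    W<L {i} h = ≢⇒<L (λ q → h (Winj (trans q (sym wd))))

    ¬<→≤ : ∀ {N} {i j : Fin N} → ¬ (i < j) → j ≤ i
    ¬<→≤ {i = i} {j} h with <-cmp i j
    ... | tri< a _ _ = ⊥-elim (h a)
    ... | tri≈ _ refl _ = ≤-refl
    ... | tri> _ _ c = ℕ.<⇒≤ c

    module NotDescending (i j : Fin (suc n)) (di : d ≤ i) (ij : i < j) (wij : W i < W j) where
      j≢d : j ≢ d
      j≢d q = <-irrefl (sym q) (ℕ.≤-<-trans di ij)
      i≢d : i ≢ d
      i≢d q = <-irrefl refl (ℕ.<-≤-trans (subst (λ x → x < W j) (trans (cong W q) wd) wij) (≤L (W j)))
      d<i : d < i
      d<i = ≤∧≢⇒< di (λ q → i≢d (sym q))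
      i<L : i < L
      i<L = ℕ.<-≤-trans ij (≤L j)
      i≢L : i ≢ L
      i≢L q = <-irrefl q i<L
      Wi≢e : W i ≢ e
      Wi≢e q = i≢L (Winj (trans q (sym wn)))
      -- otherwise d, i, j, n would form a 4231
      Wi<e : W i < e
      Wi<e with <-cmp (W i) e
      ... | tri< a _ _ = a
      ... | tri≈ _ b _ = ⊥-elim (Wi≢e b)
      ... | tri> _ _ c with j F.≟ L
      ...   | yes refl = ⊥-elim (<-asym c (subst (W i <_) wn wij))
      ...   | no j≢L = ⊥-elim (av2 (contains-pattern w p4231 d<i ij (≢⇒<L j≢L) (subst (_< W i) (sym wn) c) wij (W<L j≢d) eqs))
        where
        eqs : ∀ x → W (V4 d i j L x) ≡ V4 (W L) (W i) (W j) L (p4231 x)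
        eqs i0 = wd
        eqs i1 = refl
        eqs i2 = refl
        eqs i3 = refl

      no3412 : ∀ p → p < d → e < W p → ⊥
      no3412 p pd ep = av1 (contains-pattern w p3412 pd d<i i<L (subst (W i <_) (sym wn) Wi<e) (subst (_< W p) (sym wn) ep) (W<L (λ q → <-irrefl q pd)) eqs)
        where
        eqs : ∀ x → W (V4 p d i L x) ≡ V4 (W i) (W L) (W p) L (p3412 x)
        eqs i0 = refl
        eqs i1 = wd
        eqs i2 = refl
        eqs i3 = refl

      after-d : ∀ a → e < a → a ≢ L → d < Wi a
      after-d a ea aL with <-cmp (Wi a) d
      ... | tri< x _ _ = ⊥-elim (no3412 (Wi a) x (subst (e <_) (sym (inverseʳ w)) ea))
      ... | tri≈ _ y _ = ⊥-elim (aL (trans (sym (inverseʳ w)) (trans (cong W y) wd)))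
      ... | tri> _ _ z = z

      c2 : C2
      c2 a b ea ab with e F.≟ a
      ... | yes refl = subst (q <_) (trans (sym (inverseˡ w)) (cong Wi wn)) (≢⇒<L q≢L)
        where
        q : Fin (suc n)
        q = Wi b
        q≢L : q ≢ L
        q≢L h = <-irrefl (trans (sym wn) (trans (cong W (sym h)) (inverseʳ w))) ab
      ... | no e≢a with b F.≟ L
      ...   | yes refl = subst (_< p) (trans (sym (inverseˡ w)) (cong Wi wd)) d<p
        where
        p : Fin (suc n)
        p = Wi a
        d<p : d < p
        d<p = after-d a (≤∧≢⇒< ea e≢a) (λ h → <-irrefl h ab)
      ...   | no b≢L with <-cmp q p
        where
        p : Fin (suc n)
        p = Wi a
        q : Fin (suc n)
        q = Wi b
      ...     | tri< y _ _ = y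
      ...     | tri≈ _ y _ = ⊥-elim (<-irrefl (trans (sym (inverseʳ w)) (trans (cong W (sym y)) (inverseʳ w))) ab)
      ...     | tri> _ _ pq = ⊥-elim (av2 (contains-pattern w p4231 d<p pq (≢⇒<L q≢L)
                                (subst₂ _<_ (sym wn) (sym (inverseʳ w)) e<a)
                                (subst₂ _<_ (sym (inverseʳ w)) (sym (inverseʳ w)) ab)
                                (W<L (λ h → <-irrefl (sym h) d<q)) eqs))
        where
        p : Fin (suc n)
        p = Wi a
        q : Fin (suc n)
        q = Wi b
        e<a : e < a
        e<a = ≤∧≢⇒< ea e≢a
        d<p : d < p
        d<p = after-d a e<a (λ h → <-irrefl h (ℕ.<-≤-trans ab (≤L b)))
        d<q : d < q
        d<q = after-d b (<-trans e<a ab) b≢L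
        q≢L : q ≢ L
        q≢L h = <-irrefl (trans (sym wn) (trans (cong W (sym h)) (inverseʳ w))) (<-trans e<a ab)
        eqs : ∀ x → W (V4 d p q L x) ≡ V4 (W L) (W p) (W q) L (p4231 x)
        eqs i0 = wd
        eqs i1 = refl
        eqs i2 = refl
        eqs i3 = refl

    C1? : Dec C1
    C1? = all? λ i → all? λ j → (d ≤? i) →-dec ((i <? j) →-dec (W j <? W i))

    dichotomy : C1 ⊎ C2
    dichotomy with C1?
    ... | yes c = inj₁ c
    ... | no nc with ¬∀⟶∃¬ (suc n) _ (λ i → all? λ j → (d ≤? i) →-dec ((i <? j) →-dec (W j <? W i))) nc
    ...   | i , ¬row with ¬∀⟶∃¬ (suc n) _ (λ j → (d ≤? i) →-dec ((i <? j) →-dec (W j <? W i))) ¬row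
    ...     | j , nd = inj₂ (NotDescending.c2 i j di ij (≤∧≢⇒< (¬<→≤ wji) (λ h → <-irrefl (Winj h) ij)))
      where
      di : d ≤ i
      di with d ≤? i
      ... | yes x = x
      ... | no x = ⊥-elim (nd (λ y → ⊥-elim (x y)))
      ij : i < j
      ij with i <? j
      ... | yes x = x
      ... | no x = ⊥-elim (nd (λ _ y → ⊥-elim (x y)))
      wji : ¬ (W j < W i)
      wji h = nd (λ _ _ → h)

module Factorization where

  -- The factorisation R_w = [m+1]_q R_{w'} in the two cases, as instances of
  -- VertexDeletion.DeleteVertex.
  -- (C1) Delete position d, where w(d) = n is maximal.  Its neighbours in
  --      G_w are the positions after d (every later value is smaller), and
  --      C1 makes them pairwise inversions: a clique of n − d vertices, all
  --      larger than d.
  -- (C2) Delete the last position n, with w(n) = e.  Its neighbours are the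
  --      positions with value > e, and C2 makes them pairwise inversions: a
  --      clique of n − e vertices, all smaller than n.

  open import Defs
  open BoolFacts using (==-refl; ==-false; dec-true; dec-false; dec-sound)
  open FilterLemmas
  open VertexDeletion using (touches; module DeleteVertex)
  open ApexSum using (edgeAt)
  open Relabel
  open InversionGraph using (pairs; isEdge; module Deletion)
  open PermutationCounting using (count-permuted; countAbove)
  open import Data.Nat using (ℕ; suc; _∸_)
  import Data.Nat.Properties as ℕ
  open import Data.Bool using (Bool; true; false; _∧_; _∨_; not; if_then_else_)
  import Data.Bool as B
  open import Data.Bool.Properties using (∧-zeroʳ; ∧-identityʳ; ∨-zeroʳ)
  open import Data.Fin using (Fin; toℕ; fromℕ; _<_; _≤_) renaming (_<?_ to _<ᶠ?_)
  import Data.Fin.Properties as FP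
  open import Data.Fin.Permutation using (Permutation′; _⟨$⟩ʳ_; _⟨$⟩ˡ_; inverseˡ)
  open import Data.List using (List; []; _∷_; map; concatMap; allFin; _++_)
  open import Data.List.Membership.Propositional using (_∈_)
  open import Data.List.Membership.Propositional.Properties using (∈-allFin; ∈-map⁺; ∈-++⁺ˡ; ∈-++⁺ʳ; ∈-filter⁺; ∈-filter⁻)
  open import Data.List.Relation.Unary.Any using (here; there)
  import Data.List.Relation.Unary.All as All
  open import Data.List.Relation.Unary.AllPairs using (_∷_)
  open import Data.List.Relation.Unary.Unique.Propositional using (Unique)
  open import Data.List.Relation.Unary.Unique.Propositional.Properties using (allFin⁺; filter⁺)
  open import Data.Product using (_,_; proj₂)
  open import Data.Sum using (_⊎_; inj₁; inj₂)
  open import Relation.Nullary using (¬_; ⌊_⌋)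
  open import Relation.Binary using (tri<; tri≈; tri>)
  open import Relation.Binary.PropositionalEquality
  open import Data.Empty using (⊥-elim)
  open ≡-Reasoning
  pairs-mem : ∀ {M} (i j : Fin M) → (i , j) ∈ pairs M
  pairs-mem {M} i j = ∈-concatMap⁺ (λ i → map (λ j → (i , j)) (allFin M)) (∈-allFin i) (∈-map⁺ (λ j → (i , j)) (∈-allFin j))
    where
    ∈-concatMap⁺ : ∀ {A C : Set} (f : A → List C) {xs x y} → x ∈ xs → y ∈ f x → y ∈ concatMap f xs
    ∈-concatMap⁺ f {x ∷ xs} (here refl) m = ∈-++⁺ˡ m
    ∈-concatMap⁺ f {x' ∷ xs} (there mx) m = ∈-++⁺ʳ (f x') (∈-concatMap⁺ f mx m)

  edge-mem : ∀ {M} (G : Graph M) i j → isEdge G (i , j) ≡ true → (i , j) ∈ edges G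
  edge-mem G i j h = ∈-filter⁺ (λ e → B._≟_ (isEdge G e) true) (pairs-mem i j) h

  edgesAt-rows : ∀ {M} (G : Graph M) v → filt (touches v) (edges G) ≡
    concatMap (λ i → map (λ j → (i , j)) (filt (λ j → isEdge G (i , j) ∧ touches v (i , j)) (allFin M))) (allFin M)
  edgesAt-rows {M} G v = begin
    filt (touches v) (filt (isEdge G) (pairs M))
      ≡⟨ filt-filt (touches v) (isEdge G) (pairs M) ⟩
    filt (λ e → isEdge G e ∧ touches v e) (pairs M)
      ≡⟨ filt-concatMap (λ e → isEdge G e ∧ touches v e) (λ i → map (λ j → (i , j)) (allFin M)) (allFin M) ⟩
    concatMap (λ i → filt (λ e → isEdge G e ∧ touches v e) (map (λ j → (i , j)) (allFin M))) (allFin M)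
      ≡⟨ concatMap-cong _ _ (allFin M) (λ i _ → filt-map (λ e → isEdge G e ∧ touches v e) (λ j → (i , j)) (allFin M)) ⟩
    _ ∎

  filt-== : ∀ {M} (x₀ : Fin M) xs → Unique xs → x₀ ∈ xs → filt (λ j → j ==ᶠ x₀) xs ≡ x₀ ∷ []
  filt-== x₀ (x ∷ xs) (ax ∷ u) (here refl) rewrite ==-refl x =
    cong (x ∷_) (filt-none _ xs (λ y m → ==-false (λ e → All.lookup ax m (sym e))))
  filt-== x₀ (x ∷ xs) (ax ∷ u) (there m) rewrite ==-false {a = x} {b = x₀} (λ e → All.lookup ax m e) = filt-== x₀ xs u m

  isEdge-inversion : ∀ {M} (w : Permutation′ M) {i j} → i < j → (w ⟨$⟩ʳ j) < (w ⟨$⟩ʳ i) → isEdge (invGraph w) (i , j) ≡ true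
  isEdge-inversion w {i} {j} p q rewrite dec-true (i <ᶠ? j) p | dec-true ((w ⟨$⟩ʳ j) <ᶠ? (w ⟨$⟩ʳ i)) q = refl

  isEdge-noInversion : ∀ {M} (w : Permutation′ M) {i j} → ¬ ((w ⟨$⟩ʳ j) < (w ⟨$⟩ʳ i)) → isEdge (invGraph w) (i , j) ≡ false
  isEdge-noInversion w {i} {j} q rewrite dec-false ((w ⟨$⟩ʳ j) <ᶠ? (w ⟨$⟩ʳ i)) q with ⌊ i <ᶠ? j ⌋
  ... | true = refl
  ... | false = refl

  isEdge-unordered : ∀ {M} (w : Permutation′ M) {i j} → ¬ (i < j) → isEdge (invGraph w) (i , j) ≡ false
  isEdge-unordered w {i} {j} q rewrite dec-false (i <ᶠ? j) q = refl

  ≢⇒<L : ∀ {n} {i : Fin (suc n)} → i ≢ fromℕ n → i < fromℕ n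
  ≢⇒<L h = FP.≤∧≢⇒< (FP.≤fromℕ _) h

  ¬L< : ∀ {n} (j : Fin (suc n)) → ¬ (fromℕ n < j)
  ¬L< j p = ℕ.<-irrefl refl (ℕ.<-≤-trans p (FP.≤fromℕ j))

  module Common (n : ℕ) (w : Permutation′ (suc n)) where
    G : Graph (suc n)
    G = invGraph w

    AF : List (Fin (suc n))
    AF = allFin (suc n)

    W : Fin (suc n) → Fin (suc n)
    W i = w ⟨$⟩ʳ i

    Winj : ∀ {i j} → W i ≡ W j → i ≡ j
    Winj {i} {j} h = trans (sym (inverseˡ w)) (trans (cong (w ⟨$⟩ˡ_) h) (inverseˡ w))

    inversion-lifted : ∀ v {x y} → x ≢ v → y ≢ v → x < y → W y < W x →
      (x , y) ∈ map (Punch.liftPair v) (edges (invGraph (flat w v)))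
    inversion-lifted v {x} {y} xv yv xy wyx = subst ((x , y) ∈_) (Deletion.edgesAvoiding w v)
      (∈-filter⁺ (λ e → B._≟_ (not (touches v e)) true) (edge-mem G x y (isEdge-inversion w xy wyx))
                 (cong₂ (λ a b → not (a ∨ b)) (==-false xv) (==-false yv)))

    K-clique : ∀ v (K : List (Fin (suc n))) → (∀ {k} → k ∈ K → k ≢ v) →
      (∀ {x y} → x ∈ K → y ∈ K → x < y → W y < W x) →
      ∀ {x y} → x ∈ K → y ∈ K → x ≢ y →
      ((x , y) ∈ map (Punch.liftPair v) (edges (invGraph (flat w v)))) ⊎
      ((y , x) ∈ map (Punch.liftPair v) (edges (invGraph (flat w v))))
    K-clique v K K≢v dec {x} {y} mx my xy with FP.<-cmp x y
    ... | tri< p _ _ = inj₁ (inversion-lifted v (K≢v mx) (K≢v my) p (dec mx my p))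
    ... | tri≈ _ p _ = ⊥-elim (xy p)
    ... | tri> _ _ p = inj₂ (inversion-lifted v (K≢v my) (K≢v mx) p (dec my mx p))

  module DeleteMax (n : ℕ) (w : Permutation′ (suc n)) (d : Fin (suc n))
    (wd : w ⟨$⟩ʳ d ≡ fromℕ n)
    (c1 : ∀ i j → d ≤ i → i < j → (w ⟨$⟩ʳ j) < (w ⟨$⟩ʳ i)) where
    open Common n w

    K : List (Fin (suc n))
    K = filt (λ j → ⌊ d <ᶠ? j ⌋) AF

    W<d : ∀ {j} → j ≢ d → W j < W d
    W<d {j} h = subst (W j <_) (sym wd) (≢⇒<L (λ e → h (Winj (trans e (sym wd)))))

    ¬Wd< : ∀ i → ¬ (W d < W i)
    ¬Wd< i p = ¬L< (W i) (subst (_< W i) wd p)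

    otherRow-empty : ∀ i → i ≢ d → ∀ j → (isEdge G (i , j) ∧ touches d (i , j)) ≡ false
    otherRow-empty i id j rewrite ==-false id with FP.<-cmp j d
    ... | tri≈ _ refl _ rewrite isEdge-noInversion w {i} {d} (¬Wd< i) = refl
    ... | tri< p _ _ rewrite ==-false {a = j} {b = d} (λ q → FP.<-irrefl q p) = ∧-zeroʳ (isEdge G (i , j))
    ... | tri> _ _ p rewrite ==-false {a = j} {b = d} (λ q → FP.<-irrefl (sym q) p) = ∧-zeroʳ (isEdge G (i , j))

    row-d : ∀ j → (isEdge G (d , j) ∧ touches d (d , j)) ≡ ⌊ d <ᶠ? j ⌋
    row-d j rewrite ==-refl d | ∧-identityʳ (isEdge G (d , j)) with FP.<-cmp d j
    ... | tri< p _ _ = trans (isEdge-inversion w p (W<d (λ e → FP.<-irrefl (sym e) p))) (sym (dec-true (d <ᶠ? j) p))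
    ... | tri≈ np _ _ = trans (isEdge-unordered w np) (sym (dec-false (d <ᶠ? j) np))
    ... | tri> np _ _ = trans (isEdge-unordered w np) (sym (dec-false (d <ᶠ? j) np))

    edgesAt : filt (touches d) (edges G) ≡ map (edgeAt false d) K
    edgesAt = trans (edgesAt-rows G d) (trans
      (concatMap-single (λ i → map (λ j → (i , j)) (filt (λ j → isEdge G (i , j) ∧ touches d (i , j)) AF)) AF d (allFin⁺ (suc n)) (∈-allFin d)
        (λ i _ id → cong (map (λ j → (i , j))) (filt-none (λ j → isEdge G (i , j) ∧ touches d (i , j)) AF (λ j _ → otherRow-empty i id j))))
      (cong (map (λ j → (d , j))) (filt-cong row-d AF)))

    uK : Unique K
    uK = filter⁺ (λ j → B._≟_ ⌊ d <ᶠ? j ⌋ true) (allFin⁺ (suc n))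

    K>d : ∀ {k} → k ∈ K → d < k
    K>d {k} m = dec-sound (d <ᶠ? k) (proj₂ (∈-filter⁻ (λ j → B._≟_ ⌊ d <ᶠ? j ⌋ true) {xs = AF} m))

    K≢d : ∀ {k} → k ∈ K → k ≢ d
    K≢d m e = FP.<-irrefl (sym e) (K>d m)

    factor : Rw w ≈ₚ (qint (suc (n ∸ toℕ d)) ⊛ Rw (flat w d))
    factor = subst (λ m → Rw w ≈ₚ (qint (suc m) ⊛ Rw (flat w d))) (countAbove n d)
      (DeleteVertex.R-deleteVertex G (invGraph (flat w d)) d false K uK K≢d (Deletion.edgesAvoiding w d) edgesAt
        (K-clique d K K≢d (λ {x} {y} mx _ → c1 x y (ℕ.<⇒≤ (K>d mx)))))

  module DeleteLast (n : ℕ) (w : Permutation′ (suc n)) (e : Fin (suc n))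
    (wn : w ⟨$⟩ʳ fromℕ n ≡ e)
    (c2 : ∀ a b → e ≤ a → a < b → (w ⟨$⟩ˡ b) < (w ⟨$⟩ˡ a)) where
    open Common n w

    L : Fin (suc n)
    L = fromℕ n

    above : Fin (suc n) → Bool
    above i = ⌊ e <ᶠ? W i ⌋

    K : List (Fin (suc n))
    K = filt above AF

    column-L : ∀ i → isEdge G (i , L) ≡ above i
    column-L i with FP.<-cmp e (W i)
    ... | tri< p _ _ = trans (isEdge-inversion w (≢⇒<L (λ q → FP.<-irrefl (trans (sym wn) (cong W (sym q))) p)) (subst (_< W i) (sym wn) p))
                             (sym (dec-true (e <ᶠ? W i) p))
    ... | tri≈ np _ _ = trans (isEdge-noInversion w (λ q → np (subst (_< W i) wn q))) (sym (dec-false (e <ᶠ? W i) np))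
    ... | tri> np _ _ = trans (isEdge-noInversion w (λ q → np (subst (_< W i) wn q))) (sym (dec-false (e <ᶠ? W i) np))

    entry-at-L : ∀ i j → (isEdge G (i , j) ∧ touches L (i , j)) ≡ ((j ==ᶠ L) ∧ above i)
    entry-at-L i j with FP.<-cmp j L
    ... | tri≈ _ refl _ rewrite ==-refl L | ∨-zeroʳ (i ==ᶠ L) | ∧-identityʳ (isEdge G (i , L)) = column-L i
    ... | tri> _ _ p = ⊥-elim (¬L< j p)
    ... | tri< p _ _ rewrite ==-false {a = j} {b = L} (λ q → FP.<-irrefl q p) with FP.<-cmp i L
    ...   | tri≈ _ refl _ rewrite isEdge-unordered w {L} {j} (¬L< j) = refl
    ...   | tri< q _ _ rewrite ==-false {a = i} {b = L} (λ r → FP.<-irrefl r q) = ∧-zeroʳ (isEdge G (i , j))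
    ...   | tri> _ _ q = ⊥-elim (¬L< i q)

    row : ∀ i b → above i ≡ b →
      map (λ j → (i , j)) (filt (λ j → isEdge G (i , j) ∧ touches L (i , j)) AF) ≡ (if b then (i , L) ∷ [] else [])
    row i true h = cong (map (λ j → (i , j)))
      (trans (filt-cong (λ j → trans (entry-at-L i j) (trans (cong ((j ==ᶠ L) ∧_) h) (∧-identityʳ _))) AF)
             (filt-== L AF (allFin⁺ (suc n)) (∈-allFin L)))
    row i false h = cong (map (λ j → (i , j)))
      (filt-none (λ j → isEdge G (i , j) ∧ touches L (i , j)) AF
                 (λ j _ → trans (entry-at-L i j) (trans (cong ((j ==ᶠ L) ∧_) h) (∧-zeroʳ _))))

    edgesAt : filt (touches L) (edges G) ≡ map (edgeAt true L) K
    edgesAt = trans (edgesAt-rows G L)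
      (trans (concatMap-cong (λ i → map (λ j → (i , j)) (filt (λ j → isEdge G (i , j) ∧ touches L (i , j)) AF))
                             (λ i → if above i then (i , L) ∷ [] else []) AF (λ i _ → row i (above i) refl))
             (concatMap-if above (λ i → (i , L)) AF))

    uK : Unique K
    uK = filter⁺ (λ j → B._≟_ (above j) true) (allFin⁺ (suc n))

    K>e : ∀ {k} → k ∈ K → e < W k
    K>e {k} m = dec-sound (e <ᶠ? W k) (proj₂ (∈-filter⁻ (λ j → B._≟_ (above j) true) {xs = AF} m))

    K≢L : ∀ {k} → k ∈ K → k ≢ L
    K≢L m q = FP.<-irrefl (trans (sym wn) (cong W (sym q))) (K>e m)

    decreasing : ∀ {x y} → x ∈ K → y ∈ K → x < y → W y < W x
    decreasing {x} {y} mx my xy with FP.<-cmp (W x) (W y)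
    ... | tri< p _ _ = ⊥-elim (FP.<-asym xy (subst₂ _<_ (inverseˡ w) (inverseˡ w) (c2 (W x) (W y) (ℕ.<⇒≤ (K>e mx)) p)))
    ... | tri≈ _ p _ = ⊥-elim (FP.<-irrefl (Winj p) xy)
    ... | tri> _ _ p = p

    factor : Rw w ≈ₚ (qint (suc (n ∸ toℕ e)) ⊛ Rw (flat w L))
    factor = subst (λ m → Rw w ≈ₚ (qint (suc m) ⊛ Rw (flat w L)))
      (trans (count-permuted w (λ z → ⌊ e <ᶠ? z ⌋)) (countAbove n e))
      (DeleteVertex.R-deleteVertex G (invGraph (flat w L)) L true K uK K≢L (Deletion.edgesAvoiding w L) edgesAt
        (K-clique L K K≢L decreasing))

open import Defs
open Dichotomy using (module Avoiding)
open Factorization using (module DeleteMax; module DeleteLast)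
open import Data.Nat using (ℕ; suc; _∸_)
open import Data.Fin using (Fin; toℕ; fromℕ; _<_; _≤_)
open import Data.Fin.Permutation using (Permutation′; _⟨$⟩ʳ_; _⟨$⟩ˡ_)
open import Data.Product using (_×_; _,_)
open import Data.Sum using (_⊎_)
open import Relation.Binary.PropositionalEquality using (_≡_)

proposition6p2 : (n : ℕ) (w : Permutation′ (suc n)) (d e : Fin (suc n)) →
    Avoids w p3412 → Avoids w p4231 →
    w ⟨$⟩ʳ d ≡ fromℕ n → w ⟨$⟩ʳ fromℕ n ≡ e →
    let C1 = ∀ i j → d ≤ i → i < j → (w ⟨$⟩ʳ j) < (w ⟨$⟩ʳ i)
        C2 = ∀ a b → e ≤ a → a < b → (w ⟨$⟩ˡ b) < (w ⟨$⟩ˡ a)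
    in (C1 ⊎ C2)
       × (C1 → Rw w ≈ₚ (qint (suc (n ∸ toℕ d)) ⊛ Rw (flat w d)))
       × (C2 → Rw w ≈ₚ (qint (suc (n ∸ toℕ e)) ⊛ Rw (flat w (fromℕ n))))
proposition6p2 n w d e avoids3412 avoids4231 wd wn =
  Avoiding.dichotomy n w d e avoids3412 avoids4231 wd wn ,
  (λ c1 → DeleteMax.factor n w d wd c1) ,
  (λ c2 → DeleteLast.factor n w e wn c2)
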